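{- Let $n\ge3$. The number of permutations in $S_n$ equivalent to the identity $\iota_n=12\cdots n$ under adjacent $\{\{123,132,321\}\}$-equivalence is $$\begin{cases}\frac32\,k(k+1)(2k-1)! & \text{if } n=2k+1 \text{ is odd},\\[2pt] \frac32\,k\left(k-\frac13\right)(2k-2)!-(2k-3)!! & \text{if } n=2k \text{ is even},\end{cases}$$ where for odd positive $m$, $m!!=1\cdot3\cdot5\cdots m$.
   Context: Permutations are written as words $\pi_1\cdots\pi_n$. A sequence of distinct integers $a_1a_2a_3$ has pattern $\sigma\in S_3$ if $a_s<a_t\iff\sigma_s<\sigma_t$. An adjacent move on $\pi\in S_n$ chooses three consecutive positions $i,i+1,i+2$ with $\pi_i\pi_{i+1}\pi_{i+2}$ of pattern $\sigma\in\{123,132,321\}$ and rearranges these three values in these positions to have a pattern $\sigma'\in\{123,132,321\}$. Equivalence is the equivalence relation generated by such moves. -}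

module Defs where

open import Data.Nat using (ℕ; zero; suc; _+_; _*_; _<_)
open import Data.List using (List; []; _∷_; _++_; map; upTo)
open import Data.Product using (_×_; ∃-syntax)
open import Data.Sum using (_⊎_)
open import Relation.Binary.PropositionalEquality using (_≡_)
open import Data.List.Relation.Binary.Permutation.Propositional using (_↭_)
open import Relation.Binary.Construct.Closure.Equivalence using (EqClosure)

-- the identity permutation ι_n = 1 2 ⋯ n, as a word (list of values)
ι : ℕ → List ℕ
ι n = map suc (upTo n)

InS : ℕ → List ℕ → Set
InS n π = π ↭ ι n

Pat123 Pat132 Pat321 : ℕ → ℕ → ℕ → Set
Pat123 a b c = a < b × b < c
Pat132 a b c = a < c × c < b
Pat321 a b c = c < b × b < a

Allowed : ℕ → ℕ → ℕ → Set
Allowed a b c = Pat123 a b c ⊎ Pat132 a b c ⊎ Pat321 a b c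

data Move : List ℕ → List ℕ → Set where
  move : (pre post : List ℕ) (a b c a' b' c' : ℕ) →
         Allowed a b c → Allowed a' b' c' →
         (a' ∷ b' ∷ c' ∷ []) ↭ (a ∷ b ∷ c ∷ []) →
         Move (pre ++ a ∷ b ∷ c ∷ post) (pre ++ a' ∷ b' ∷ c' ∷ post)

_≈_ : List ℕ → List ℕ → Set
_≈_ = EqClosure Move

_!! : ℕ → ℕ
zero !! = 1
suc zero !! = 1
suc (suc m) !! = suc (suc m) * (m !!)

module Submission where

-- Call a word good if (i) 1 stands at an odd position and, if 2 precedes 1,
-- then 2 stands at an even position, and (ii) it is not exceptional, i.e. not
-- of the form a₁b₁a₂b₂⋯ with aᵢ < bᵢ and a₁ > a₂ > ⋯.  Condition (i) is
-- checked by a four-state automaton whose final state is unchanged by every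
-- move (it cannot tell the three allowed arrangements of a triple apart), and
-- an exceptional word admits no move at all; as ι n is good, its whole class
-- is good.  Conversely, in a good permutation 1 can be moved two places to
-- the left at a time until it comes first, and behind a least entry any two
-- adjacent entries can be transposed, so the rest can then be sorted.  Hence
-- the class of ι n consists exactly of the good permutations.
--
-- Counting: all permutations arise by inserting 2 and then 1 into an
-- arrangement of 3, …, n, and the automaton's verdict depends only on the two
-- insertion indices, which gives (n−2)! · accepting (n−1) accepted
-- permutations with accepting in closed form.  The accepted exceptional ones
-- are the words σ 1 2 with σ an exceptional arrangement of 3, …, n: there
-- are (n−3)!! of them for even n and none for odd n.

open import Defs
open import Function using (_∘_)
open import Algebra.Properties.CommutativeSemigroup using (interchange)
open import Data.Bool using (Bool; true; false; not; _∧_; if_then_else_)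
open import Data.Bool.Properties using (not-involutive)
open import Data.Empty using (⊥; ⊥-elim)
open import Data.Nat using (ℕ; zero; suc; _+_; _*_; _∸_; _<_; _≤_; z≤n; s≤s; _<?_; _≤?_; _≟_; _!)
open import Data.Nat.Properties
open import Data.Nat.Tactic.RingSolver using (solve-∀)
open import Data.List using (List; []; _∷_; _++_; [_]; length; map; concatMap; applyUpTo; upTo; filter; drop; reverse)
open import Data.List.Properties using (++-assoc; ++-identityʳ; length-++; length-map; ∷-injective; ++-cancelʳ; length-applyUpTo; concatMap-++; reverse-++)
open import Data.List.Relation.Unary.All as All using (All; []; _∷_)
import Data.List.Relation.Unary.All.Properties as Allₚ
open import Data.List.Relation.Unary.Any using (here; there)
open import Data.List.Relation.Unary.AllPairs using (AllPairs; []; _∷_)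
import Data.List.Relation.Unary.AllPairs.Properties as AllPairsₚ
open import Data.List.Relation.Unary.Unique.Propositional using (Unique)
import Data.List.Relation.Unary.Unique.Propositional.Properties as Uniqueₚ
open import Data.List.Membership.Propositional using (_∈_; _∉_; find; lose)
open import Data.List.Membership.Propositional.Properties using (∈-++⁺ʳ; ∈-++⁻; ∈-insert; ∈-∃++; ∈-map⁺; ∈-map⁻; ∈-filter⁺; ∈-filter⁻; ∈-applyUpTo⁺; ∈-applyUpTo⁻; ∈-concatMap⁺; ∈-concatMap⁻)
open import Data.List.Membership.Propositional.Properties.WithK using (unique∧set⇒bag)
open import Data.List.Membership.DecPropositional _≟_ using (_∈?_)
open import Data.List.Relation.Binary.BagAndSetEquality using (∼bag⇒↭)
open import Data.List.Relation.Binary.Permutation.Propositional as ↭ using (_↭_; prep; swap; ↭-refl; ↭-sym; ↭-trans; ↭-isEquivalence)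
open import Data.List.Relation.Binary.Permutation.Propositional.Properties using (All-resp-↭; ∈-resp-↭; ++⁺ˡ; ++⁺ʳ; ↭-length; drop-mid; drop-∷; shift; ++-comm)
open import Data.Product using (Σ-syntax; ∃-syntax; _×_; _,_; proj₁; proj₂)
open import Data.Sum using (_⊎_; inj₁; inj₂)
open import Function.Bundles using (_⇔_; mk⇔)
open import Relation.Nullary using (¬_; Dec; yes; no; does; ¬?; _×-dec_)
open import Relation.Binary using (tri<; tri≈; tri>)
open import Relation.Binary.PropositionalEquality using (_≡_; _≢_; refl; sym; trans; cong; cong₂; subst; subst₂; module ≡-Reasoning)
import Relation.Binary.Construct.Closure.Equivalence as EqClosure
open import Relation.Binary.Construct.Closure.ReflexiveTransitive using (ε; _◅_; _◅◅_)
open import Relation.Binary.Construct.Closure.Symmetric using (fwd; bwd)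

infixr 5 _⟫_
_⟫_ : ∀ {x y z} → x ≈ y → y ≈ z → x ≈ z
_⟫_ = _◅◅_

≈-refl : ∀ {x} → x ≈ x
≈-refl = ε

≈-sym : ∀ {x y} → x ≈ y → y ≈ x
≈-sym = EqClosure.symmetric Move

≡⇒≈ : ∀ {x y} → x ≡ y → x ≈ y
≡⇒≈ refl = ≈-refl

≈-prefix : ∀ p {x y} → x ≈ y → (p ++ x) ≈ (p ++ y)
≈-prefix p = EqClosure.gmap (p ++_) prefixMove
  where
  prefixMove : ∀ {x y} → Move x y → Move (p ++ x) (p ++ y)
  prefixMove (move pre post a b c a' b' c' al al' pm) =
    subst₂ Move (++-assoc p pre (a ∷ b ∷ c ∷ post)) (++-assoc p pre (a' ∷ b' ∷ c' ∷ post))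
      (move (p ++ pre) post a b c a' b' c' al al' pm)

≈-suffix : ∀ s {x y} → x ≈ y → (x ++ s) ≈ (y ++ s)
≈-suffix s = EqClosure.gmap (_++ s) suffixMove
  where
  suffixMove : ∀ {x y} → Move x y → Move (x ++ s) (y ++ s)
  suffixMove (move pre post a b c a' b' c' al al' pm) =
    subst₂ Move (sym (++-assoc pre (a ∷ b ∷ c ∷ post) s)) (sym (++-assoc pre (a' ∷ b' ∷ c' ∷ post) s))
      (move pre (post ++ s) a b c a' b' c' al al' pm)

move-sym : ∀ {x y} → Move x y → Move y x
move-sym (move pre post a b c a' b' c' al al' pm) = move pre post a' b' c' a b c al' al (↭-sym pm)

move⇒↭ : ∀ {x y} → Move x y → x ↭ y
move⇒↭ (move pre post a b c a' b' c' al al' pm) = ++⁺ˡ pre (↭-sym (++⁺ʳ post pm))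

≈⇒↭ : ∀ {x y} → x ≈ y → x ↭ y
≈⇒↭ = EqClosure.fold ↭-isEquivalence move⇒↭

data Arrangement : Set where
  p123 p132 p321 : Arrangement

arrange : Arrangement → ℕ → ℕ → ℕ → List ℕ → List ℕ
arrange p123 x y z q = x ∷ y ∷ z ∷ q
arrange p132 x y z q = x ∷ z ∷ y ∷ q
arrange p321 x y z q = z ∷ y ∷ x ∷ q

rearrange : ∀ x y z q → x < y → y < z → ∀ i j → arrange i x y z q ≈ arrange j x y z q
rearrange x y z q x<y y<z i j = ≈-sym (fromSorted i) ⟫ fromSorted j
  where
  123-allowed : Allowed x y z
  123-allowed = inj₁ (x<y , y<z)
  fromSorted : ∀ i → arrange p123 x y z q ≈ arrange i x y z q
  fromSorted p123 = ≈-refl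
  fromSorted p132 = EqClosure.return
    (move [] q x y z x z y 123-allowed (inj₂ (inj₁ (x<y , y<z))) (prep x (swap z y ↭-refl)))
  fromSorted p321 = EqClosure.return
    (move [] q x y z z y x 123-allowed (inj₂ (inj₂ (x<y , y<z)))
      (↭-trans (swap z y ↭-refl) (↭-trans (prep y (swap z x ↭-refl)) (swap y x ↭-refl))))

Unique-resp-↭ : ∀ {A : Set} {xs ys : List A} → Unique xs → xs ↭ ys → Unique ys
Unique-resp-↭ u ↭.refl = u
Unique-resp-↭ (px ∷ u) (prep x p) = All-resp-↭ p px ∷ Unique-resp-↭ u p
Unique-resp-↭ ((x≢y ∷ ax) ∷ ay ∷ u) (swap x y p) =
  ((λ y≡x → x≢y (sym y≡x)) ∷ All-resp-↭ p ay) ∷ All-resp-↭ p ax ∷ Unique-resp-↭ u p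
Unique-resp-↭ u (↭.trans p q) = Unique-resp-↭ (Unique-resp-↭ u p) q

Unique-++⁻ˡ : ∀ {A : Set} (p : List A) {s} → Unique (p ++ s) → Unique p
Unique-++⁻ˡ [] u = []
Unique-++⁻ˡ (x ∷ p) (px ∷ u) = Allₚ.++⁻ˡ p px ∷ Unique-++⁻ˡ p u

Unique-++⁻ʳ : ∀ {A : Set} (p : List A) {s} → Unique (p ++ s) → Unique s
Unique-++⁻ʳ [] u = u
Unique-++⁻ʳ (x ∷ p) (_ ∷ u) = Unique-++⁻ʳ p u

Unique-after : ∀ {A : Set} (P : List A) {ℓ S} → Unique (P ++ ℓ ∷ S) → Unique S
Unique-after P u with Unique-++⁻ʳ P u
... | _ ∷ v = v

Unique-mid : ∀ {A : Set} (P : List A) {ℓ S} → Unique (P ++ ℓ ∷ S) → All (ℓ ≢_) (P ++ S)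
Unique-mid [] (ℓ≢ ∷ _) = ℓ≢
Unique-mid (p ∷ P) (p≢ ∷ u) = (λ ℓ≡p → All.lookup p≢ (∈-insert P) (sym ℓ≡p)) ∷ Unique-mid P u

All-delete : ∀ {A : Set} {P : A → Set} (xs : List A) {y ys} → All P (xs ++ y ∷ ys) → All P (xs ++ ys)
All-delete xs pa with Allₚ.++⁻ʳ xs pa
... | _ ∷ pb = Allₚ.++⁺ (Allₚ.++⁻ˡ xs pa) pb

All-mid : ∀ {A : Set} {P : A → Set} (xs : List A) {y ys} → All P (xs ++ y ∷ ys) → P y
All-mid xs pa = All.lookup pa (∈-insert xs)

aboveMin : ∀ (L : List ℕ) {m R} → All (m ≤_) (L ++ m ∷ R) → Unique (L ++ m ∷ R) → All (m <_) (L ++ R)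
aboveMin L le u = All.zipWith (λ (m≤x , m≢x) → ≤∧≢⇒< m≤x m≢x) (All-delete L le , Unique-mid L u)

splitAtMin : ∀ (y : ℕ) L → Σ[ P ∈ List ℕ ] Σ[ ℓ ∈ ℕ ] Σ[ S ∈ List ℕ ] (y ∷ L ≡ P ++ ℓ ∷ S) × All (ℓ ≤_) (y ∷ L)
splitAtMin y [] = [] , y , [] , refl , ≤-refl ∷ []
splitAtMin y (z ∷ L) with splitAtMin z L
... | P , ℓ , S , eq , le with y ≤? ℓ
... | yes y≤ℓ = [] , y , z ∷ L , refl , ≤-refl ∷ All.map (≤-trans y≤ℓ) le
... | no y≰ℓ = y ∷ P , ℓ , S , cong (y ∷_) eq , <⇒≤ (≰⇒> y≰ℓ) ∷ le

splitLast : ∀ {A : Set} (x : A) xs → Σ[ Q ∈ List A ] Σ[ z ∈ A ] x ∷ xs ≡ Q ++ [ z ]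
splitLast x [] = [] , x , refl
splitLast x (y ∷ xs) with splitLast y xs
... | Q , z , eq = x ∷ Q , z , cong (x ∷_) eq

splitLastTwo : ∀ {A : Set} (x y : A) xs → Σ[ Q ∈ List A ] Σ[ z ∈ A ] Σ[ w ∈ A ] x ∷ y ∷ xs ≡ Q ++ z ∷ w ∷ []
splitLastTwo x y [] = [] , x , y , refl
splitLastTwo x y (v ∷ xs) with splitLastTwo y v xs
... | Q , z , w , eq = x ∷ Q , z , w , cong (x ∷_) eq

isEven : ℕ → Bool
isEven zero = true
isEven (suc zero) = false
isEven (suc (suc n)) = isEven n

isEven-suc : ∀ n → isEven (suc n) ≡ not (isEven n)
isEven-suc zero = refl
isEven-suc (suc zero) = refl
isEven-suc (suc (suc n)) = isEven-suc n

isEven-double : ∀ k → isEven (k + k) ≡ true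
isEven-double zero = refl
isEven-double (suc k) = trans (cong (λ t → isEven (suc t)) (+-suc k k)) (isEven-double k)

isEven-split : ∀ a b → isEven (a + suc b) ≡ true → isEven b ≡ not (isEven a)
isEven-split zero b h = trans (sym (not-involutive (isEven b))) (cong not (trans (sym (isEven-suc b)) h))
isEven-split (suc zero) b h = h
isEven-split (suc (suc a)) b h = isEven-split a b h

half : ∀ n → isEven n ≡ true → Σ[ k ∈ ℕ ] n ≡ k + k
half zero _ = zero , refl
half (suc zero) ()
half (suc (suc n)) e with half n e
... | k , refl = suc k , cong suc (sym (+-suc k k))

minHop : ∀ {m a b} → m < a → m < b → a ≢ b →
  Σ[ c ∈ ℕ ] Σ[ d ∈ ℕ ] (m < c × m < d) × (∀ r → (m ∷ a ∷ b ∷ r) ≈ (c ∷ d ∷ m ∷ r))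
minHop {m} {a} {b} m<a m<b a≢b with <-cmp a b
... | tri< a<b _ _ = b , a , (m<b , m<a) , λ r → rearrange m a b r m<a a<b p123 p321
... | tri≈ _ a≡b _ = ⊥-elim (a≢b a≡b)
... | tri> _ _ b<a = a , b , (m<a , m<b) , λ r → rearrange m b a r m<b b<a p132 p321

swapNextToMin : ∀ m w x y s → m < w → m < x → m < y → w ≢ x → w ≢ y → x ≢ y →
  (m ∷ w ∷ x ∷ y ∷ s) ≈ (m ∷ w ∷ y ∷ x ∷ s)
swapNextToMin m w x y s m<w m<x m<y w≢x w≢y x≢y with <-cmp w x | <-cmp w y | <-cmp x y
... | tri≈ _ e _ | _ | _ = ⊥-elim (w≢x e)
... | _ | tri≈ _ e _ | _ = ⊥-elim (w≢y e)
... | _ | _ | tri≈ _ e _ = ⊥-elim (x≢y e)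
... | tri< w<x _ _ | tri< w<y _ _ | tri< x<y _ _ = ≈-prefix [ m ] (rearrange w x y s w<x x<y p123 p132)
... | tri< w<x _ _ | tri< w<y _ _ | tri> _ _ y<x = ≈-prefix [ m ] (rearrange w y x s w<y y<x p132 p123)
... | tri< w<x _ _ | tri> _ _ y<w | tri< x<y _ _ = ⊥-elim (<-asym w<x (<-trans x<y y<w))
... | tri> _ _ x<w | tri< w<y _ _ | tri> _ _ y<x = ⊥-elim (<-asym w<y (<-trans y<x x<w))
... | tri< w<x _ _ | tri> _ _ y<w | tri> _ _ y<x =
  rearrange m w x (y ∷ s) m<w w<x p123 p132 ⟫ ≈-prefix [ m ] (rearrange y w x s y<w w<x p321 p123)
  ⟫ rearrange m y w (x ∷ s) m<y y<w p123 p132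
... | tri> _ _ x<w | tri< w<y _ _ | tri< x<y _ _ =
  rearrange m x w (y ∷ s) m<x x<w p132 p123 ⟫ ≈-prefix [ m ] (rearrange x w y s x<w w<y p123 p321)
  ⟫ rearrange m w y (x ∷ s) m<w w<y p132 p123
... | tri> _ _ x<w | tri> _ _ y<w | tri< x<y _ _ =
  rearrange m x w (y ∷ s) m<x x<w p132 p123 ⟫ ≈-prefix [ m ] (rearrange x y w s x<y y<w p132 p321)
... | tri> _ _ x<w | tri> _ _ y<w | tri> _ _ y<x =
  ≈-prefix [ m ] (rearrange y x w s y<x x<w p321 p132) ⟫ rearrange m y w (x ∷ s) m<y y<w p123 p132

-- Behind a least entry m, any two adjacent distinct larger entries can be
-- transposed: m hops towards them in steps of two, the transposition is done
-- next to m (at distance zero or one), and m hops back.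
swapBehindMin : ∀ m p x y s → All (m <_) (p ++ x ∷ y ∷ s) → Unique (p ++ x ∷ y ∷ s) →
  (m ∷ p ++ x ∷ y ∷ s) ≈ (m ∷ p ++ y ∷ x ∷ s)
swapBehindMin m [] x y s (m<x ∷ m<y ∷ _) ((x≢y ∷ _) ∷ _) with <-cmp x y
... | tri< x<y _ _ = rearrange m x y s m<x x<y p123 p132
... | tri≈ _ e _ = ⊥-elim (x≢y e)
... | tri> _ _ y<x = rearrange m y x s m<y y<x p132 p123
swapBehindMin m (w ∷ []) x y s (m<w ∷ m<x ∷ m<y ∷ _) ((w≢x ∷ w≢y ∷ _) ∷ (x≢y ∷ _) ∷ _) =
  swapNextToMin m w x y s m<w m<x m<y w≢x w≢y x≢y
swapBehindMin m (a ∷ b ∷ p) x y s (m<a ∷ m<b ∷ above) ((a≢b ∷ _) ∷ _ ∷ u) with minHop m<a m<b a≢b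
... | c , d , _ , hop = hop _ ⟫ ≈-prefix (c ∷ d ∷ []) (swapBehindMin m p x y s above u) ⟫ ≈-sym (hop _)

-- Consequently the part following m ∷ p, for m a least entry, can be
-- permuted arbitrarily (p is needed for the induction).
permuteBehindMin : ∀ m p {σ τ} → σ ↭ τ → All (m <_) (p ++ σ) → Unique (p ++ σ) → (m ∷ p ++ σ) ≈ (m ∷ p ++ τ)
permuteBehindMin m p ↭.refl _ _ = ≈-refl
permuteBehindMin m p {x ∷ σ} {x ∷ τ} (prep x σ↭τ) above u =
  subst₂ (λ a b → (m ∷ a) ≈ (m ∷ b)) (++-assoc p [ x ] σ) (++-assoc p [ x ] τ)
    (permuteBehindMin m (p ++ [ x ]) σ↭τ (reassoc (All (m <_)) above) (reassoc Unique u))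
  where
  reassoc : (P : List ℕ → Set) → P (p ++ x ∷ σ) → P ((p ++ [ x ]) ++ σ)
  reassoc P = subst P (sym (++-assoc p [ x ] σ))
permuteBehindMin m p {x ∷ y ∷ σ} {y ∷ x ∷ τ} (swap x y σ↭τ) above u =
  swapBehindMin m p x y σ above u ⟫
  subst₂ (λ a b → (m ∷ a) ≈ (m ∷ b)) (++-assoc p (y ∷ x ∷ []) σ) (++-assoc p (y ∷ x ∷ []) τ)
    (permuteBehindMin m (p ++ y ∷ x ∷ []) σ↭τ (reassoc (All (m <_)) (All-resp-↭ xy↭yx above))
                                              (reassoc Unique (Unique-resp-↭ u xy↭yx)))
  where
  xy↭yx : (p ++ x ∷ y ∷ σ) ↭ (p ++ y ∷ x ∷ σ)
  xy↭yx = ++⁺ˡ p (swap x y ↭-refl)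
  reassoc : (P : List ℕ → Set) → P (p ++ y ∷ x ∷ σ) → P ((p ++ y ∷ x ∷ []) ++ σ)
  reassoc P = subst P (sym (++-assoc p (y ∷ x ∷ []) σ))
permuteBehindMin m p (↭.trans σ↭ρ ρ↭τ) above u =
  permuteBehindMin m p σ↭ρ above u ⟫
  permuteBehindMin m p ρ↭τ (All-resp-↭ (++⁺ˡ p σ↭ρ) above) (Unique-resp-↭ u (++⁺ˡ p σ↭ρ))

permuteAfterMin : ∀ m {σ τ} → σ ↭ τ → All (m <_) σ → Unique σ → (m ∷ σ) ≈ (m ∷ τ)
permuteAfterMin m = permuteBehindMin m []

slideMin : ∀ m S s → isEven (length S) ≡ true → All (m <_) S → Unique S →
  Σ[ S′ ∈ List ℕ ] ((m ∷ S ++ s) ≈ (S′ ++ m ∷ s)) × All (m <_) S′ × length S′ ≡ length S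
slideMin m [] s _ _ _ = [] , ≈-refl , [] , refl
slideMin m (a ∷ []) s () _ _
slideMin m (a ∷ b ∷ S) s even (m<a ∷ m<b ∷ above) ((a≢b ∷ _) ∷ _ ∷ u)
  with minHop m<a m<b a≢b | slideMin m S s even above u
... | c , d , (m<c , m<d) , hop | S′ , slide , above′ , len =
  c ∷ d ∷ S′ , hop _ ⟫ ≈-prefix (c ∷ d ∷ []) slide , m<c ∷ m<d ∷ above′ , cong (λ t → suc (suc t)) len

-- Every window of three consecutive entries then has pattern 231, 213 or
-- 312, so no move applies and such a word forms a class of its own.
data Exceptional : List ℕ → Set where
  pair : ∀ {a b} → a < b → Exceptional (a ∷ b ∷ [])
  extend : ∀ {a b c d r} → a < b → c < a → Exceptional (c ∷ d ∷ r) → Exceptional (a ∷ b ∷ c ∷ d ∷ r)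

exceptional? : ∀ xs → Dec (Exceptional xs)
exceptional? [] = no (λ ())
exceptional? (a ∷ []) = no (λ ())
exceptional? (a ∷ b ∷ []) with a <? b
... | yes a<b = yes (pair a<b)
... | no a≮b = no (λ { (pair a<b) → a≮b a<b })
exceptional? (a ∷ b ∷ c ∷ []) = no (λ ())
exceptional? (a ∷ b ∷ c ∷ d ∷ r) with a <? b | c <? a | exceptional? (c ∷ d ∷ r)
... | yes a<b | yes c<a | yes ex = yes (extend a<b c<a ex)
... | no a≮b | _ | _ = no (λ { (extend a<b _ _) → a≮b a<b })
... | yes _ | no c≮a | _ = no (λ { (extend _ c<a _) → c≮a c<a })
... | yes _ | yes _ | no ¬ex = no (λ { (extend _ _ ex) → ¬ex ex })

Exceptional-snoc : ∀ A {ℓ c} → Exceptional A → All (ℓ <_) A → ℓ < c → Exceptional (A ++ ℓ ∷ c ∷ [])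
Exceptional-snoc (a ∷ b ∷ []) (pair a<b) (ℓ<a ∷ _) ℓ<c = extend a<b ℓ<a (pair ℓ<c)
Exceptional-snoc (a ∷ b ∷ c ∷ d ∷ r) (extend a<b c<a ex) (_ ∷ _ ∷ above) ℓ<c =
  extend a<b c<a (Exceptional-snoc (c ∷ d ∷ r) ex above ℓ<c)

Exceptional-even : ∀ {ρ} → Exceptional ρ → isEven (length ρ) ≡ true
Exceptional-even (pair _) = refl
Exceptional-even (extend _ _ ex) = Exceptional-even ex

noAllowedWindow : ∀ pre {a b c post} → Exceptional (pre ++ a ∷ b ∷ c ∷ post) → ¬ Allowed a b c
noAllowedWindow [] (extend a<b c<a _) (inj₁ (_ , b<c)) = <-asym a<b (<-trans b<c c<a)
noAllowedWindow [] (extend a<b c<a _) (inj₂ (inj₁ (a<c , _))) = <-asym a<c c<a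
noAllowedWindow [] (extend a<b c<a _) (inj₂ (inj₂ (_ , b<a))) = <-asym a<b b<a
noAllowedWindow (x ∷ []) {a} {b} {c} (extend x<a b<x ex) allowed = window (secondPair ex) allowed
  where
  secondPair : ∀ {b c r} → Exceptional (b ∷ c ∷ r) → b < c
  secondPair (pair b<c) = b<c
  secondPair (extend b<c _ _) = b<c
  window : b < c → ¬ Allowed a b c
  window b<c (inj₁ (a<b , _)) = <-asym a<b (<-trans b<x x<a)
  window b<c (inj₂ (inj₁ (_ , c<b))) = <-asym b<c c<b
  window b<c (inj₂ (inj₂ (c<b , _))) = <-asym b<c c<b
noAllowedWindow (x ∷ y ∷ pre) {a} {b} {c} {post} ex allowed with dropPair (pre ++ a ∷ b ∷ c ∷ post) ex
  where
  dropPair : ∀ {x y} w → Exceptional (x ∷ y ∷ w) → w ≡ [] ⊎ Exceptional w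
  dropPair [] _ = inj₁ refl
  dropPair (_ ∷ _) (extend _ _ ex) = inj₂ ex
... | inj₂ ex′ = noAllowedWindow pre ex′ allowed
... | inj₁ empty with pre | empty
... | [] | ()
... | _ ∷ _ | ()

Exceptional-rigid : ∀ {x y} → Exceptional x → ¬ Move x y
Exceptional-rigid ex (move pre post a b c a' b' c' allowed _ _) = noAllowedWindow pre ex allowed

EndsInDescent : List ℕ → Set
EndsInDescent L = Σ[ Q ∈ List ℕ ] Σ[ z ∈ ℕ ] Σ[ w ∈ ℕ ] (L ≈ (Q ++ z ∷ w ∷ [])) × w < z

EndsInDescent-≈ : ∀ {L L′} → L ≈ L′ → EndsInDescent L′ → EndsInDescent L
EndsInDescent-≈ L≈L′ (Q , z , w , L′≈ , w<z) = Q , z , w , L≈L′ ⟫ L′≈ , w<z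

lastPairDescent : ∀ P ℓ S x y → All (ℓ <_) (S ++ x ∷ y ∷ []) → Unique (S ++ x ∷ y ∷ []) →
  EndsInDescent (P ++ ℓ ∷ S ++ x ∷ y ∷ [])
lastPairDescent P ℓ S x y above u with <-cmp x y | Unique-++⁻ʳ S u
... | tri> _ _ y<x | _ = P ++ ℓ ∷ S , x , y , ≡⇒≈ (sym (++-assoc P (ℓ ∷ S) (x ∷ y ∷ []))) , y<x
... | tri≈ _ x≡y _ | (x≢y ∷ _) ∷ _ = ⊥-elim (x≢y x≡y)
... | tri< x<y _ _ | _ = P ++ ℓ ∷ S , y , x ,
  ≈-prefix P (swapBehindMin ℓ S x y [] above u) ⟫ ≡⇒≈ (sym (++-assoc P (ℓ ∷ S) (y ∷ x ∷ []))) , x<y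

minAtOddIndex : ∀ P ℓ S → isEven (length S) ≡ true → isEven (length P) ≡ false →
  Unique (P ++ ℓ ∷ S) → All (ℓ <_) (P ++ S) → EndsInDescent (P ++ ℓ ∷ S)
minAtOddIndex [] ℓ S _ () _ _
minAtOddIndex (p ∷ P) ℓ S evenS _ u above
  with slideMin ℓ S [] evenS (Allₚ.++⁻ʳ (p ∷ P) above) (Unique-after (p ∷ P) u)
... | S′ , slide , aboveS′ , _ with splitLast p (P ++ S′)
... | Q , z , pPS′≡Qz = Q , z , ℓ , chain , ℓ<z
  where
  chain : ((p ∷ P) ++ ℓ ∷ S) ≈ (Q ++ z ∷ ℓ ∷ [])
  chain = ≡⇒≈ (cong (λ t → (p ∷ P) ++ ℓ ∷ t) (sym (++-identityʳ S))) ⟫ ≈-prefix (p ∷ P) slide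
    ⟫ ≡⇒≈ (trans (sym (++-assoc (p ∷ P) S′ [ ℓ ])) (trans (cong (_++ [ ℓ ]) pPS′≡Qz) (++-assoc Q [ z ] [ ℓ ])))
  ℓ<z : ℓ < z
  ℓ<z = All-mid Q (subst (All (ℓ <_)) pPS′≡Qz (Allₚ.++⁺ (Allₚ.++⁻ˡ (p ∷ P) above) aboveS′))

tailParity : ∀ k P (ℓ : ℕ) S → length (P ++ ℓ ∷ S) ≡ suc (suc (k + k)) → isEven (length S) ≡ not (isEven (length P))
tailParity k P ℓ S len = isEven-split (length P) (length S) (trans (cong isEven (trans (sym (length-++ P)) len)) (isEven-double k))

-- Split at the least entry ℓ.  If
-- an odd number of entries precedes ℓ, it slides to the end.  Otherwise an
-- odd number follows: if at least three, reorder the last two behind ℓ; if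
-- exactly one, c, then the part before ℓ is shorter and not exceptional,
-- ends in a descent z w by induction, and z w ℓ c ≈ ℓ w z c.
mutual
  endsInDescent : ∀ k L → length L ≡ suc (suc (k + k)) → Unique L → ¬ Exceptional L → EndsInDescent L
  endsInDescent k [] () _ _
  endsInDescent k (y ∷ L) len u ¬ex with splitAtMin y L
  ... | P , ℓ , S , yL≡PℓS , le = subst EndsInDescent (sym yL≡PℓS)
        (descentAtMin k P ℓ S (trans (cong length (sym yL≡PℓS)) len) u′ (aboveMin P (subst (All (ℓ ≤_)) yL≡PℓS le) u′)
                      (λ ex → ¬ex (subst Exceptional (sym yL≡PℓS) ex)))
    where
    u′ : Unique (P ++ ℓ ∷ S)
    u′ = subst Unique yL≡PℓS u

  descentAtMin : ∀ k P ℓ S → length (P ++ ℓ ∷ S) ≡ suc (suc (k + k)) → Unique (P ++ ℓ ∷ S) →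
    All (ℓ <_) (P ++ S) → ¬ Exceptional (P ++ ℓ ∷ S) → EndsInDescent (P ++ ℓ ∷ S)
  descentAtMin k P ℓ S len u above ¬ex with isEven (length P) in evenP | tailParity k P ℓ S len
  ... | false | parityS = minAtOddIndex P ℓ S parityS evenP u above
  ... | true | parityS = minAtEvenIndex k P ℓ S parityS len u above ¬ex

  minAtEvenIndex : ∀ k P ℓ S → isEven (length S) ≡ false → length (P ++ ℓ ∷ S) ≡ suc (suc (k + k)) →
    Unique (P ++ ℓ ∷ S) → All (ℓ <_) (P ++ S) → ¬ Exceptional (P ++ ℓ ∷ S) → EndsInDescent (P ++ ℓ ∷ S)
  minAtEvenIndex k P ℓ [] () _ _ _ _
  minAtEvenIndex k P ℓ (c ∷ []) _ len u above ¬ex = singleFollower k P ℓ c lenP u above ¬ex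
    where
    lenP : length P ≡ k + k
    lenP = suc-injective (suc-injective (trans (sym (+-comm (length P) 2)) (trans (sym (length-++ P)) len)))
  minAtEvenIndex k P ℓ (c ∷ c′ ∷ S) _ _ u above _ with splitLastTwo c c′ S
  ... | S₀ , x , y , cc′S≡ = subst (λ t → EndsInDescent (P ++ ℓ ∷ t)) (sym cc′S≡)
        (lastPairDescent P ℓ S₀ x y (subst (All (ℓ <_)) cc′S≡ (Allₚ.++⁻ʳ P above))
                                   (subst Unique cc′S≡ (Unique-after P u)))

  singleFollower : ∀ k P ℓ c → length P ≡ k + k → Unique (P ++ ℓ ∷ c ∷ []) → All (ℓ <_) (P ++ c ∷ []) →
    ¬ Exceptional (P ++ ℓ ∷ c ∷ []) → EndsInDescent (P ++ ℓ ∷ c ∷ [])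
  singleFollower k [] ℓ c _ _ (ℓ<c ∷ []) ¬ex = ⊥-elim (¬ex (pair ℓ<c))
  singleFollower zero (p ∷ P) ℓ c () _ _ _
  singleFollower (suc k) (p ∷ P) ℓ c lenP u above ¬ex with Allₚ.++⁻ʳ (p ∷ P) above
  ... | ℓ<c ∷ [] with exceptional? (p ∷ P)
  ... | yes ex = ⊥-elim (¬ex (Exceptional-snoc (p ∷ P) ex (Allₚ.++⁻ˡ (p ∷ P) above) ℓ<c))
  ... | no ¬exP with endsInDescent k (p ∷ P) (trans lenP (cong suc (+-suc k k))) (Unique-++⁻ˡ (p ∷ P) u) ¬exP
  ... | Q , z , w , P≈Qzw , w<z with Allₚ.++⁻ʳ Q (All-resp-↭ (≈⇒↭ P≈Qzw) (Allₚ.++⁻ˡ (p ∷ P) above))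
  ... | ℓ<z ∷ ℓ<w ∷ [] = EndsInDescent-≈ toℓwzc (lastPairDescent Q ℓ (w ∷ []) z c (ℓ<w ∷ ℓ<z ∷ ℓ<c ∷ []) u-wzc)
    where
    toℓwzc : ((p ∷ P) ++ ℓ ∷ c ∷ []) ≈ (Q ++ ℓ ∷ w ∷ z ∷ c ∷ [])
    toℓwzc = ≈-suffix (ℓ ∷ c ∷ []) P≈Qzw ⟫ ≡⇒≈ (++-assoc Q (z ∷ w ∷ []) (ℓ ∷ c ∷ []))
      ⟫ ≈-prefix Q (rearrange ℓ w z (c ∷ []) ℓ<w w<z p321 p123)
    u-wzc : Unique (w ∷ z ∷ c ∷ [])
    u-wzc = Unique-after Q (Unique-resp-↭ u (≈⇒↭ toℓwzc))

-- Read a word from left to right, keeping track of the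
-- parity of the current position (true at positions 1, 3, 5, …).  Only the
-- values 1 and 2 matter: the word is accepted (state good) iff 1 stands at
-- an odd position and, if 2 comes before 1, then 2 stands at an even one.
-- start: neither 1 nor 2 read; saw2: 2 read at an even position, 1 not
-- yet; good, dead: the final verdict, reached when 1 is read (or when 2 is
-- read at an odd position before 1).
data State : Set where
  start saw2 good dead : State

data Letter : Set where
  one two other : Letter

letter : ℕ → Letter
letter 1 = one
letter 2 = two
letter _ = other

step : State → Bool → Letter → State
step s _ other = s
step start true one = good
step start false one = dead
step saw2 true one = good
step saw2 false one = dead
step start true two = dead
step start false two = saw2
step s _ _ = s

run : State → Bool → List ℕ → State
run s p [] = s
run s p (x ∷ xs) = run (step s p (letter x)) (not p) xs

parityAfter : Bool → List ℕ → Bool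
parityAfter p [] = p
parityAfter p (x ∷ xs) = parityAfter (not p) xs

run-++ : ∀ s p xs ys → run s p (xs ++ ys) ≡ run (run s p xs) (parityAfter p xs) ys
run-++ s p [] ys = refl
run-++ s p (x ∷ xs) ys = run-++ (step s p (letter x)) (not p) xs ys

parityAfter-length : ∀ p xs → parityAfter p xs ≡ (if isEven (length xs) then p else not p)
parityAfter-length p [] = refl
parityAfter-length p (x ∷ xs) rewrite parityAfter-length (not p) xs | isEven-suc (length xs)
  with isEven (length xs)
... | true = refl
... | false = not-involutive p

-- Letters of three values 1 ≤ x < y < z: at most x is 1 and at most x or y is 2.
data SortedLetters : Letter → Letter → Letter → Set where
  one-two-other : SortedLetters one two other
  one-other-other : SortedLetters one other other
  two-other-other : SortedLetters two other other
  other-other-other : SortedLetters other other other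

letter-big : ∀ {z} → 3 ≤ z → letter z ≡ other
letter-big (s≤s (s≤s (s≤s _))) = refl

sortedLetters : ∀ {x y z} → 1 ≤ x → x < y → y < z → SortedLetters (letter x) (letter y) (letter z)
sortedLetters {1} {2} _ _ 2<z = subst (SortedLetters one two) (sym (letter-big 2<z)) one-two-other
sortedLetters {1} {0} _ () _
sortedLetters {1} {1} _ (s≤s ()) _
sortedLetters {1} {suc (suc (suc _))} _ _ y<z =
  subst (SortedLetters one other) (sym (letter-big (<-trans (s≤s (s≤s (s≤s z≤n))) y<z))) one-other-other
sortedLetters {2} {0} _ () _
sortedLetters {2} {1} _ (s≤s ()) _
sortedLetters {2} {2} _ (s≤s (s≤s ())) _
sortedLetters {2} {suc (suc (suc _))} _ _ y<z =
  subst (SortedLetters two other) (sym (letter-big (<-trans (s≤s (s≤s (s≤s z≤n))) y<z))) two-other-other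
sortedLetters {suc (suc (suc _))} _ x<y y<z =
  subst₂ (SortedLetters other) (sym (letter-big (≤-trans 3≤x (<⇒≤ x<y))))
    (sym (letter-big (≤-trans 3≤x (<⇒≤ (<-trans x<y y<z))))) other-other-other
  where
  3≤x = s≤s (s≤s (s≤s z≤n))

run3 : State → Bool → Letter → Letter → Letter → State
run3 s p a b c = step (step (step s p a) (not p) b) (not (not p)) c

-- The invariance at the heart of the argument: the automaton cannot tell the
-- three allowed arrangements of an increasing triple apart.
window-132 : ∀ {a b c} → SortedLetters a b c → ∀ s p → run3 s p a c b ≡ run3 s p a b c
window-132 one-two-other start true = refl
window-132 one-two-other start false = refl
window-132 one-two-other saw2 true = refl
window-132 one-two-other saw2 false = refl
window-132 one-two-other good p = refl
window-132 one-two-other dead p = refl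
window-132 one-other-other s p = refl
window-132 two-other-other s p = refl
window-132 other-other-other s p = refl

window-321 : ∀ {a b c} → SortedLetters a b c → ∀ s p → run3 s p c b a ≡ run3 s p a b c
window-321 one-two-other start true = refl
window-321 one-two-other start false = refl
window-321 one-two-other saw2 true = refl
window-321 one-two-other saw2 false = refl
window-321 one-two-other good p = refl
window-321 one-two-other dead p = refl
window-321 one-other-other s true = refl
window-321 one-other-other s false = refl
window-321 two-other-other s true = refl
window-321 two-other-other s false = refl
window-321 other-other-other s p = refl

sortTriple : ∀ {a b c} → Allowed a b c →
  Σ[ x ∈ ℕ ] Σ[ y ∈ ℕ ] Σ[ z ∈ ℕ ] Σ[ i ∈ Arrangement ] x < y × y < z × (a ∷ b ∷ c ∷ [] ≡ arrange i x y z [])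
sortTriple {a} {b} {c} (inj₁ (a<b , b<c)) = a , b , c , p123 , a<b , b<c , refl
sortTriple {a} {b} {c} (inj₂ (inj₁ (a<c , c<b))) = a , c , b , p132 , a<c , c<b , refl
sortTriple {a} {b} {c} (inj₂ (inj₂ (c<b , b<a))) = c , b , a , p321 , c<b , b<a , refl

arrange-↭ : ∀ i x y z → arrange i x y z [] ↭ (x ∷ y ∷ z ∷ [])
arrange-↭ p123 x y z = ↭-refl
arrange-↭ p132 x y z = prep x (swap z y ↭-refl)
arrange-↭ p321 x y z = ↭-trans (swap z y ↭-refl) (↭-trans (prep y (swap z x ↭-refl)) (swap y x ↭-refl))

run-arrange : ∀ s p i {x y z} → 1 ≤ x → x < y → y < z → run s p (arrange i x y z []) ≡ run s p (x ∷ y ∷ z ∷ [])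
run-arrange s p p123 _ _ _ = refl
run-arrange s p p132 1≤x x<y y<z = window-132 (sortedLetters 1≤x x<y y<z) s p
run-arrange s p p321 1≤x x<y y<z = window-321 (sortedLetters 1≤x x<y y<z) s p

increasing-↭⇒≡ : ∀ {xs ys : List ℕ} → AllPairs _<_ xs → AllPairs _<_ ys → xs ↭ ys → xs ≡ ys
increasing-↭⇒≡ {[]} {[]} _ _ _ = refl
increasing-↭⇒≡ {[]} {y ∷ ys} _ _ p with ↭-length p
... | ()
increasing-↭⇒≡ {x ∷ xs} {[]} _ _ p with ↭-length p
... | ()
increasing-↭⇒≡ {x ∷ xs} {y ∷ ys} (x< ∷ incx) (y< ∷ incy) p
  with ∈-resp-↭ p (here refl) | ∈-resp-↭ (↭-sym p) (here refl)
... | here refl | _ = cong (x ∷_) (increasing-↭⇒≡ incx incy (drop-∷ p))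
... | there _ | here refl = cong (x ∷_) (increasing-↭⇒≡ incx incy (drop-∷ p))
... | there x∈ys | there y∈xs = ⊥-elim (<-asym (All.lookup y< x∈ys) (All.lookup x< y∈xs))

window-invariant : ∀ s p {a b c a′ b′ c′} → Allowed a b c → Allowed a′ b′ c′ →
  (a′ ∷ b′ ∷ c′ ∷ []) ↭ (a ∷ b ∷ c ∷ []) → 1 ≤ a → 1 ≤ b → 1 ≤ c →
  run s p (a ∷ b ∷ c ∷ []) ≡ run s p (a′ ∷ b′ ∷ c′ ∷ [])
window-invariant s p {a} {b} {c} {a′} {b′} {c′} allowed allowed′ perm 1≤a 1≤b 1≤c with sortTriple allowed | sortTriple allowed′
... | x , y , z , i , x<y , y<z , abc≡ | x′ , y′ , z′ , j , x<y′ , y<z′ , abc≡′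
  with increasing-↭⇒≡ (increasing x<y′ y<z′) (increasing x<y y<z)
         (↭-trans (↭-sym (arrange-↭ j x′ y′ z′)) (↭-trans (subst₂ _↭_ abc≡′ abc≡ perm) (arrange-↭ i x y z)))
  where
  increasing : ∀ {u v w} → u < v → v < w → AllPairs _<_ (u ∷ v ∷ w ∷ [])
  increasing u<v v<w = (u<v ∷ <-trans u<v v<w ∷ []) ∷ (v<w ∷ []) ∷ [] ∷ []
... | refl = begin
  run s p (a ∷ b ∷ c ∷ [])     ≡⟨ cong (run s p) abc≡ ⟩
  run s p (arrange i x y z [])  ≡⟨ run-arrange s p i 1≤x x<y y<z ⟩
  run s p (x ∷ y ∷ z ∷ [])      ≡⟨ sym (run-arrange s p j 1≤x x<y y<z) ⟩
  run s p (arrange j x y z [])  ≡⟨ cong (run s p) (sym abc≡′) ⟩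
  run s p (a′ ∷ b′ ∷ c′ ∷ [])  ∎
  where
  open ≡-Reasoning
  1≤x : 1 ≤ x
  1≤x = leastOf i (subst (All (1 ≤_)) abc≡ (1≤a ∷ 1≤b ∷ 1≤c ∷ []))
    where
    leastOf : ∀ i → All (1 ≤_) (arrange i x y z []) → 1 ≤ x
    leastOf p123 (h ∷ _) = h
    leastOf p132 (h ∷ _) = h
    leastOf p321 (_ ∷ _ ∷ h ∷ _) = h

run-move : ∀ s p {π π′} → Move π π′ → All (1 ≤_) π → run s p π ≡ run s p π′
run-move s p (move pre post a b c a′ b′ c′ allowed allowed′ perm) pos
  with Allₚ.++⁻ʳ pre pos
... | 1≤a ∷ 1≤b ∷ 1≤c ∷ _ = begin
  run s p (pre ++ a ∷ b ∷ c ∷ post)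
    ≡⟨ run-++ s p pre _ ⟩
  run (run s p pre) (parityAfter p pre) ((a ∷ b ∷ c ∷ []) ++ post)
    ≡⟨ run-++ _ _ (a ∷ b ∷ c ∷ []) post ⟩
  run (run s′ p′ (a ∷ b ∷ c ∷ [])) (not (not (not p′))) post
    ≡⟨ cong (λ t → run t (not (not (not p′))) post) (window-invariant s′ p′ allowed allowed′ perm 1≤a 1≤b 1≤c) ⟩
  run (run s′ p′ (a′ ∷ b′ ∷ c′ ∷ [])) (not (not (not p′))) post
    ≡⟨ sym (run-++ _ _ (a′ ∷ b′ ∷ c′ ∷ []) post) ⟩
  run s′ p′ ((a′ ∷ b′ ∷ c′ ∷ []) ++ post)
    ≡⟨ sym (run-++ s p pre _) ⟩
  run s p (pre ++ a′ ∷ b′ ∷ c′ ∷ post) ∎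
  where
  open ≡-Reasoning
  s′ = run s p pre
  p′ = parityAfter p pre

Good : List ℕ → Set
Good π = (run start true π ≡ good) × ¬ Exceptional π

Good-move : ∀ {x y} → Move x y → All (1 ≤_) x → Good x → Good y
Good-move m pos (accepted , ¬ex) = trans (sym (run-move start true m pos)) accepted , λ ex → Exceptional-rigid ex (move-sym m)

Good-≈ : ∀ {x y} → x ≈ y → All (1 ≤_) x → Good x → Good y
Good-≈ ε pos g = g
Good-≈ (fwd m ◅ rest) pos g = Good-≈ rest (All-resp-↭ (move⇒↭ m) pos) (Good-move m pos g)
Good-≈ (bwd m ◅ rest) pos g = Good-≈ rest (All-resp-↭ (move⇒↭ (move-sym m)) pos) (Good-move (move-sym m) pos g)

absorbing : ∀ {s} → s ≡ good ⊎ s ≡ dead → ∀ p xs → run s p xs ≡ s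
absorbing _ p [] = refl
absorbing {s} h p (x ∷ xs) = trans (cong (λ t → run t (not p) xs) (stays h (letter x))) (absorbing h (not p) xs)
  where
  stays : s ≡ good ⊎ s ≡ dead → ∀ l → step s p l ≡ s
  stays _ other = refl
  stays (inj₁ refl) one = refl
  stays (inj₁ refl) two = refl
  stays (inj₂ refl) one = refl
  stays (inj₂ refl) two = refl

run-good : ∀ p xs → run good p xs ≡ good
run-good = absorbing (inj₁ refl)

run-dead : ∀ p xs → run dead p xs ≡ dead
run-dead = absorbing (inj₂ refl)

dead≢good : ∀ p xs → run dead p xs ≢ good
dead≢good p xs eq with trans (sym (run-dead p xs)) eq
... | ()

run-above2 : ∀ s p xs → All (2 <_) xs → run s p xs ≡ s
run-above2 s p [] _ = refl
run-above2 s p (x ∷ xs) (2<x ∷ above) rewrite letter-big 2<x = run-above2 s (not p) xs above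

parityAfter-true : ∀ xs → parityAfter true xs ≡ isEven (length xs)
parityAfter-true xs with isEven (length xs) | parityAfter-length true xs
... | true | eq = eq
... | false | eq = eq

run-without1 : ∀ s p xs → s ≢ good → All (_≢ 1) xs → run s p xs ≢ good
run-without1 s p [] s≢good _ = s≢good
run-without1 s p (x ∷ xs) s≢good (x≢1 ∷ rest) = run-without1 (step s p (letter x)) (not p) xs (noOne s p x s≢good x≢1) rest
  where
  noOne : ∀ s p x → s ≢ good → x ≢ 1 → step s p (letter x) ≢ good
  noOne s p 1 _ x≢1 = ⊥-elim (x≢1 refl)
  noOne start true 2 _ _ ()
  noOne start false 2 _ _ ()
  noOne saw2 p 2 s≢good _ = s≢good
  noOne dead p 2 _ _ ()
  noOne good p 2 s≢good _ = s≢good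
  noOne s p 0 s≢good _ = s≢good
  noOne s p (suc (suc (suc x))) s≢good _ = s≢good

oneAtOddPosition : ∀ L R → All (_≢ 1) L → run start true (L ++ 1 ∷ R) ≡ good → isEven (length L) ≡ true
oneAtOddPosition L R no1 accepted with isEven (length L) in evenL
... | true = refl
... | false = ⊥-elim (dead≢good true R (trans (cong (λ s → run s true R) (sym (killed (run start true L) notYet))) afterOne))
  where
  notYet : run start true L ≢ good
  notYet = run-without1 start true L (λ ()) no1
  afterOne : run (step (run start true L) false one) true R ≡ good
  afterOne = subst (λ q → run (step (run start true L) q one) (not q) R ≡ good)
               (trans (parityAfter-true L) evenL) (trans (sym (run-++ start true L (1 ∷ R))) accepted)
  killed : ∀ s → s ≢ good → step s false one ≡ dead
  killed start _ = refl
  killed saw2 _ = refl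
  killed good s≢good = ⊥-elim (s≢good refl)
  killed dead _ = refl

twoAtEvenPosition : ∀ P R → All (2 <_) P → run start true (P ++ 2 ∷ R) ≡ good → isEven (length P) ≡ false
twoAtEvenPosition P R above accepted with isEven (length P) in evenP
... | false = refl
... | true = ⊥-elim (dead≢good false R (subst (λ q → run (step start q two) (not q) R ≡ good)
                       (trans (parityAfter-true P) evenP) afterTwo))
  where
  afterTwo : run (step start (parityAfter true P) two) (not (parityAfter true P)) R ≡ good
  afterTwo = subst (λ s → run (step s (parityAfter true P) two) (not (parityAfter true P)) R ≡ good)
               (run-above2 start true P above) (trans (sym (run-++ start true P (2 ∷ R))) accepted)

record Candidate (π : List ℕ) : Set where
  field
    distinct : Unique π
    positive : All (1 ≤_) π
    has2 : 2 ∈ π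
    good-π : Good π

Candidate-≈ : ∀ {x y} → x ≈ y → Candidate x → Candidate y
Candidate-≈ x≈y c = record
  { distinct = Unique-resp-↭ distinct x↭y
  ; positive = All-resp-↭ x↭y positive
  ; has2 = ∈-resp-↭ x↭y has2
  ; good-π = Good-≈ x≈y positive good-π
  }
  where
  open Candidate c
  x↭y = ≈⇒↭ x≈y

OneAt : ℕ → List ℕ → Set
OneAt k π = Σ[ L ∈ List ℕ ] Σ[ R ∈ List ℕ ] (π ≈ (L ++ 1 ∷ R)) × length L ≡ k + k

1<2 : 1 < 2
1<2 = s≤s (s≤s z≤n)

-- Moving 1 two places to the left, from π = L′ a b 1 R with |L′| = 2k, in
-- four cases.  If b < a: a b 1 ≈ 1 b a.
pull1-descent : ∀ k L′ a b R → length L′ ≡ k + k → 1 < b → b < a → OneAt k ((L′ ++ a ∷ b ∷ []) ++ 1 ∷ R)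
pull1-descent k L′ a b R len 1<b b<a =
  L′ , b ∷ a ∷ R , ≡⇒≈ (++-assoc L′ (a ∷ b ∷ []) (1 ∷ R)) ⟫ ≈-prefix L′ (rearrange 1 b a R 1<b b<a p321 p123) , len

-- If 2 stands at an even position before 1, with P in front of it: 2 slides
-- right across the even block S up to 1, and then z 2 1 ≈ 1 2 z.
pull1-slide2 : ∀ k P S R → length P + suc (length S) ≡ suc (suc (k + k)) → isEven (length P) ≡ false →
  All (2 <_) (P ++ S) → Unique S → OneAt k (P ++ 2 ∷ S ++ 1 ∷ R)
pull1-slide2 k [] S R _ () _ _
pull1-slide2 k (p ∷ P) S R len oddP above uS
  with slideMin 2 S (1 ∷ R) evenS (Allₚ.++⁻ʳ (p ∷ P) above) uS
  where
  evenS : isEven (length S) ≡ true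
  evenS = trans (isEven-split (length (p ∷ P)) (length S) (trans (cong isEven len) (isEven-double k)))
                (cong not oddP)
... | S′ , slide , aboveS′ , lenS′ with splitLast p (P ++ S′)
... | Q , z , pPS′≡Qz = Q , 2 ∷ z ∷ R , chain , lenQ
  where
  2<z : 2 < z
  2<z = All-mid Q (subst (All (2 <_)) pPS′≡Qz (Allₚ.++⁺ (Allₚ.++⁻ˡ (p ∷ P) above) aboveS′))
  reassoc : (p ∷ P) ++ S′ ++ 2 ∷ 1 ∷ R ≡ Q ++ z ∷ 2 ∷ 1 ∷ R
  reassoc = trans (sym (++-assoc (p ∷ P) S′ (2 ∷ 1 ∷ R)))
                  (trans (cong (_++ 2 ∷ 1 ∷ R) pPS′≡Qz) (++-assoc Q [ z ] (2 ∷ 1 ∷ R)))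
  chain : ((p ∷ P) ++ 2 ∷ S ++ 1 ∷ R) ≈ (Q ++ 1 ∷ 2 ∷ z ∷ R)
  chain = ≈-prefix (p ∷ P) slide ⟫ ≡⇒≈ reassoc ⟫ ≈-prefix Q (rearrange 1 2 z R 1<2 2<z p321 p123)
  lenQ : length Q ≡ k + k
  lenQ = +-cancelʳ-≡ 2 (length Q) (k + k) (begin
    length Q + 2                          ≡⟨ +-suc (length Q) 1 ⟩
    suc (length Q + 1)                    ≡⟨ cong suc (sym (length-++ Q)) ⟩
    suc (length (Q ++ [ z ]))             ≡⟨ cong (suc ∘ length) (sym pPS′≡Qz) ⟩
    suc (length (p ∷ P ++ S′))            ≡⟨ cong suc (length-++ (p ∷ P)) ⟩
    suc (length (p ∷ P) + length S′)      ≡⟨ cong (λ t → suc (length (p ∷ P) + t)) lenS′ ⟩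
    suc (length (p ∷ P) + length S)       ≡⟨ sym (+-suc (length (p ∷ P)) (length S)) ⟩
    length (p ∷ P) + suc (length S)       ≡⟨ len ⟩
    suc (suc (k + k))                     ≡⟨ +-comm 2 (k + k) ⟩
    k + k + 2                             ∎)
    where
    open ≡-Reasoning

-- Case 2 stands in front of 1: its position is even since π is accepted.
pull1-2before : ∀ k P S R → length (P ++ 2 ∷ S) ≡ suc (suc (k + k)) → Unique (P ++ 2 ∷ S) →
  All (1 <_) (P ++ 2 ∷ S) → run start true (P ++ 2 ∷ S ++ 1 ∷ R) ≡ good → OneAt k (P ++ 2 ∷ S ++ 1 ∷ R)
pull1-2before k P S R len u above accepted =
  pull1-slide2 k P S R (trans (sym (length-++ P)) len) oddP above2 (Unique-after P u)
  where
  above2 : All (2 <_) (P ++ S)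
  above2 = All.zipWith (λ (1<x , 2≢x) → ≤∧≢⇒< 1<x 2≢x) (All-delete P above , Unique-mid P u)
  oddP : isEven (length P) ≡ false
  oddP = twoAtEvenPosition P (S ++ 1 ∷ R) (Allₚ.++⁻ˡ P above2) accepted

oneToFrontOfFive : ∀ a b x R → 2 < a → 2 < b → 2 < x → a < b → a ≢ x → b ≢ x →
  Σ[ T ∈ List ℕ ] (a ∷ b ∷ x ∷ 2 ∷ 1 ∷ R) ≈ (1 ∷ T)
oneToFrontOfFive a b x R 2<a 2<b 2<x a<b a≢x b≢x with <-cmp a x | <-cmp b x
... | tri≈ _ a≡x _ | _ = ⊥-elim (a≢x a≡x)
... | _ | tri≈ _ b≡x _ = ⊥-elim (b≢x b≡x)
... | tri< a<x _ _ | tri< b<x _ _ = _ ,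
  rearrange a b x (2 ∷ 1 ∷ R) a<b b<x p123 p321 ⟫ ≈-prefix (x ∷ b ∷ []) (rearrange 1 2 a R 1<2 2<a p321 p123)
  ⟫ rearrange 1 b x (2 ∷ a ∷ R) (<⇒≤ 2<b) b<x p321 p123
... | tri< a<x _ _ | tri> _ _ x<b = _ ,
  rearrange a x b (2 ∷ 1 ∷ R) a<x x<b p132 p321 ⟫ ≈-prefix (b ∷ x ∷ []) (rearrange 1 2 a R 1<2 2<a p321 p123)
  ⟫ rearrange 1 x b (2 ∷ a ∷ R) (<⇒≤ 2<x) x<b p321 p123
... | tri> _ _ x<a | _ = _ ,
  ≈-prefix [ a ] (rearrange 2 x b (1 ∷ R) 2<x (<-trans x<a a<b) p321 p132)
  ⟫ ≈-prefix (a ∷ 2 ∷ []) (rearrange 1 x b R (<⇒≤ 2<x) (<-trans x<a a<b) p321 p123)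
  ⟫ rearrange 1 2 a (x ∷ b ∷ R) 1<2 2<a p321 p123

-- If a < b, 2 stands after 1 and some further entry x does too: first make
-- 1 x 2 the entries following b (1 is least), then 1 x 2 ≈ x 2 1, and 1
-- moves to the front of a b x 2 1.
pull1-2after : ∀ k L′ a b R x R′ → length L′ ≡ k + k → a < b → 2 < a → 2 < b →
  R ↭ x ∷ 2 ∷ R′ → All (1 <_) R → Unique ((L′ ++ a ∷ b ∷ []) ++ 1 ∷ R) → OneAt k ((L′ ++ a ∷ b ∷ []) ++ 1 ∷ R)
pull1-2after k L′ a b R x R′ len a<b 2<a 2<b R↭ aboveR u = L′ , proj₁ toFront , toab ⟫ ≈-prefix L′ (proj₂ toFront) , len
  where
  uR : Unique R
  uR = Unique-after (L′ ++ a ∷ b ∷ []) u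
  2<x : 2 < x
  2<x with All-resp-↭ R↭ aboveR | Unique-resp-↭ uR R↭
  ... | 1<x ∷ _ | (x≢2 ∷ _) ∷ _ = ≤∧≢⇒< 1<x (λ 2≡x → x≢2 (sym 2≡x))
  toab : ((L′ ++ a ∷ b ∷ []) ++ 1 ∷ R) ≈ (L′ ++ a ∷ b ∷ x ∷ 2 ∷ 1 ∷ R′)
  toab = ≈-prefix (L′ ++ a ∷ b ∷ []) (permuteAfterMin 1 R↭ aboveR uR ⟫ rearrange 1 2 x R′ 1<2 2<x p132 p321)
         ⟫ ≡⇒≈ (++-assoc L′ (a ∷ b ∷ []) (x ∷ 2 ∷ 1 ∷ R′))
  toFront : Σ[ T ∈ List ℕ ] (a ∷ b ∷ x ∷ 2 ∷ 1 ∷ R′) ≈ (1 ∷ T)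
  toFront with Unique-++⁻ʳ L′ (Unique-resp-↭ u (≈⇒↭ toab))
  ... | (_ ∷ a≢x ∷ _) ∷ (b≢x ∷ _) ∷ _ = oneToFrontOfFive a b x R′ 2<a 2<b 2<x a<b a≢x b≢x

-- If 2 is the only entry after 1, the part before 1 is not exceptional (or
-- π would be), so it ends in a descent z w, and z w 1 ≈ 1 w z.
pull1-last2 : ∀ k Lf → length Lf ≡ suc (suc (k + k)) → All (1 <_) Lf → Unique Lf →
  ¬ Exceptional (Lf ++ 1 ∷ 2 ∷ []) → OneAt k (Lf ++ 1 ∷ 2 ∷ [])
pull1-last2 k Lf len above u ¬ex with endsInDescent k Lf len u (λ ex → ¬ex (Exceptional-snoc Lf ex above 1<2))
... | Q , z , w , Lf≈Qzw , w<z = Q , w ∷ z ∷ 2 ∷ [] , chain , lenQ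
  where
  1<w : 1 < w
  1<w with Allₚ.++⁻ʳ Q (All-resp-↭ (≈⇒↭ Lf≈Qzw) above)
  ... | _ ∷ 1<w ∷ [] = 1<w
  chain : (Lf ++ 1 ∷ 2 ∷ []) ≈ (Q ++ 1 ∷ w ∷ z ∷ 2 ∷ [])
  chain = ≈-suffix (1 ∷ 2 ∷ []) Lf≈Qzw ⟫ ≡⇒≈ (++-assoc Q (z ∷ w ∷ []) (1 ∷ 2 ∷ []))
          ⟫ ≈-prefix Q (rearrange 1 w z (2 ∷ []) 1<w w<z p321 p123)
  lenQ : length Q ≡ k + k
  lenQ = +-cancelʳ-≡ 2 (length Q) (k + k)
           (trans (sym (length-++ Q)) (trans (sym (↭-length (≈⇒↭ Lf≈Qzw))) (trans len (+-comm 2 (k + k)))))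

singleOrPair : ∀ {A : Set} {v : A} {R} → v ∈ R → R ≡ [ v ] ⊎ Σ[ x ∈ A ] Σ[ R′ ∈ List A ] R ↭ x ∷ v ∷ R′
singleOrPair {v = v} v∈R with ∈-∃++ v∈R
... | x ∷ R₁ , R₂ , refl = inj₂ (x , R₁ ++ R₂ , prep x (shift v R₁ R₂))
... | [] , x ∷ R₂ , refl = inj₂ (x , R₂ , swap v x ↭-refl)
... | [] , [] , refl = inj₁ refl

module _ (k : ℕ) (L′ : List ℕ) (a b : ℕ) (R : List ℕ) (len : length L′ ≡ k + k)
         (cand : Candidate ((L′ ++ a ∷ b ∷ []) ++ 1 ∷ R)) where
  private
    Lf : List ℕ
    Lf = L′ ++ a ∷ b ∷ []
    open Candidate cand renaming (distinct to u; positive to pos)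
    accepted = proj₁ good-π
    ¬ex = proj₂ good-π
    lenLf : length Lf ≡ suc (suc (k + k))
    lenLf = trans (length-++ L′) (trans (+-comm (length L′) 2) (cong (λ t → suc (suc t)) len))
    above1 : All (1 <_) (Lf ++ R)
    above1 = aboveMin Lf pos u
    aboveLf : All (1 <_) Lf
    aboveLf = Allₚ.++⁻ˡ Lf above1
    uLf : Unique Lf
    uLf = Unique-++⁻ˡ Lf u

    twoBefore : (Σ[ P ∈ List ℕ ] Σ[ S ∈ List ℕ ] Lf ≡ P ++ [ 2 ] ++ S) → OneAt k (Lf ++ 1 ∷ R)
    twoBefore (P , S , Lf≡P2S) = subst (OneAt k) (sym split) (pull1-2before k P S R
      (subst (λ t → length t ≡ suc (suc (k + k))) Lf≡P2S lenLf) (subst Unique Lf≡P2S uLf)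
      (subst (All (1 <_)) Lf≡P2S aboveLf) (subst (λ t → run start true t ≡ good) split accepted))
      where
      split : Lf ++ 1 ∷ R ≡ P ++ 2 ∷ S ++ 1 ∷ R
      split = trans (cong (_++ 1 ∷ R) Lf≡P2S) (++-assoc P (2 ∷ S) (1 ∷ R))

    twoBehind : a < b → 2 ∉ Lf → 2 ∈ R → OneAt k (Lf ++ 1 ∷ R)
    twoBehind a<b 2∉Lf 2∈R with singleOrPair 2∈R | Allₚ.++⁻ʳ L′ aboveLf
    ... | inj₁ refl | _ = pull1-last2 k Lf lenLf aboveLf uLf ¬ex
    ... | inj₂ (x , R′ , R↭) | 1<a ∷ 1<b ∷ [] =
      pull1-2after k L′ a b R x R′ len a<b (above2 1<a (∈-++⁺ʳ L′ (here refl))) (above2 1<b (∈-++⁺ʳ L′ (there (here refl))))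
                   R↭ (Allₚ.++⁻ʳ Lf above1) u
      where
      above2 : ∀ {y} → 1 < y → y ∈ Lf → 2 < y
      above2 1<y y∈Lf = ≤∧≢⇒< 1<y (λ 2≡y → 2∉Lf (subst (_∈ Lf) (sym 2≡y) y∈Lf))

  pull1 : OneAt k ((L′ ++ a ∷ b ∷ []) ++ 1 ∷ R)
  pull1 with <-cmp a b | Allₚ.++⁻ʳ L′ aboveLf | Unique-++⁻ʳ L′ uLf
  ... | tri> _ _ b<a | _ ∷ 1<b ∷ [] | _ = pull1-descent k L′ a b R len 1<b b<a
  ... | tri≈ _ a≡b _ | _ | (a≢b ∷ _) ∷ _ = ⊥-elim (a≢b a≡b)
  ... | tri< a<b _ _ | _ | _ with 2 ∈? Lf | ∈-++⁻ Lf has2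
  ...   | yes 2∈Lf | _ = twoBefore (∈-∃++ 2∈Lf)
  ...   | no 2∉Lf | inj₁ 2∈Lf = ⊥-elim (2∉Lf 2∈Lf)
  ...   | no 2∉Lf | inj₂ (there 2∈R) = twoBehind a<b 2∉Lf 2∈R

double-suc : ∀ k → suc k + suc k ≡ k + k + 2
double-suc k = trans (cong suc (+-suc k k)) (+-comm 2 (k + k))

oneToFront : ∀ k L R → length L ≡ k + k → Candidate (L ++ 1 ∷ R) → Σ[ σ ∈ List ℕ ] (L ++ 1 ∷ R) ≈ (1 ∷ σ)
oneToFront zero [] R _ _ = R , ≈-refl
oneToFront zero (_ ∷ _) R () _
oneToFront (suc k) [] R () _
oneToFront (suc k) (y ∷ []) R len _ with trans (suc-injective len) (+-suc k k)
... | ()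
oneToFront (suc k) (y ∷ y′ ∷ L) R len cand with splitLastTwo y y′ L
... | L′ , a , b , yy′L≡ with pull1 k L′ a b R lenL′ (subst (λ t → Candidate (t ++ 1 ∷ R)) yy′L≡ cand)
  where
  lenL′ : length L′ ≡ k + k
  lenL′ = +-cancelʳ-≡ 2 (length L′) (k + k)
            (trans (sym (length-++ L′)) (trans (cong length (sym yy′L≡)) (trans len (double-suc k))))
... | L₁ , R₁ , toL₁ , lenL₁ with oneToFront k L₁ R₁ lenL₁ (Candidate-≈ (≡⇒≈ (cong (_++ 1 ∷ R) yy′L≡) ⟫ toL₁) cand)
... | σ , toFront = σ , ≡⇒≈ (cong (_++ 1 ∷ R) yy′L≡) ⟫ toL₁ ⟫ toFront

ι-unique : ∀ n → Unique (ι n)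
ι-unique n = Uniqueₚ.map⁺ suc-injective (Uniqueₚ.upTo⁺ n)

ι-positive : ∀ n → All (1 ≤_) (ι n)
ι-positive n = Allₚ.map⁺ (All.universal (λ _ → s≤s z≤n) (upTo n))

complete : ∀ m π → InS (suc (suc (suc m))) π → Good π → π ≈ ι (suc (suc (suc m)))
complete m π π↭ι g with ∈-∃++ (∈-resp-↭ (↭-sym π↭ι) (here refl))
... | L , R , refl with half (length L) (oneAtOddPosition L R no1 (proj₁ g))
  where
  no1 : All (_≢ 1) L
  no1 = All.map (λ 1≢x x≡1 → 1≢x (sym x≡1)) (Allₚ.++⁻ˡ L (Unique-mid L (Unique-resp-↭ (ι-unique _) (↭-sym π↭ι))))
... | k , lenL with oneToFront k L R lenL cand
  where
  cand : Candidate (L ++ 1 ∷ R)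
  cand = record { distinct = Unique-resp-↭ (ι-unique _) (↭-sym π↭ι) ; positive = All-resp-↭ (↭-sym π↭ι) (ι-positive _)
                ; has2 = ∈-resp-↭ (↭-sym π↭ι) (there (here refl)) ; good-π = g }
... | σ , toFront = toFront ⟫ permuteAfterMin 1 σ↭ (aboveMin [] (All-resp-↭ ι↭1σ (ι-positive _)) u1σ) (Unique-after [] u1σ)
  where
  ι↭1σ : ι (suc (suc (suc m))) ↭ 1 ∷ σ
  ι↭1σ = ↭-trans (↭-sym π↭ι) (≈⇒↭ toFront)
  u1σ : Unique (1 ∷ σ)
  u1σ = Unique-resp-↭ (ι-unique _) ι↭1σ
  σ↭ : σ ↭ _
  σ↭ = drop-∷ (↭-sym ι↭1σ)

∈-concatMap⁻′ : ∀ {A B : Set} (f : A → List B) {y} xs → y ∈ concatMap f xs → Σ[ x ∈ A ] x ∈ xs × y ∈ f x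
∈-concatMap⁻′ f xs y∈ = find (∈-concatMap⁻ f {xs = xs} y∈)

∈-concatMap⁺′ : ∀ {A B : Set} (f : A → List B) {x y} xs → x ∈ xs → y ∈ f x → y ∈ concatMap f xs
∈-concatMap⁺′ f xs x∈ y∈ = ∈-concatMap⁺ f {xs = xs} (lose x∈ y∈)

Unique-concatMap : ∀ {A B : Set} (f : A → List B) {xs} → Unique xs → (∀ {x} → x ∈ xs → Unique (f x)) →
  (∀ {x x′ y} → x ∈ xs → x′ ∈ xs → y ∈ f x → y ∈ f x′ → x ≡ x′) → Unique (concatMap f xs)
Unique-concatMap f {[]} _ _ _ = []
Unique-concatMap f {x ∷ xs} (x∉ ∷ u) uf disj =
  Uniqueₚ.++⁺ (uf (here refl)) (Unique-concatMap f u (uf ∘ there) (λ p q → disj (there p) (there q)))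
    (λ (y∈fx , y∈rest) → let (x′ , x′∈xs , y∈fx′) = ∈-concatMap⁻′ f xs y∈rest
                          in All.lookup x∉ x′∈xs (disj (here refl) (there x′∈xs) y∈fx y∈fx′))

length-concatMap : ∀ {A B : Set} (f : A → List B) c xs → (∀ {x} → x ∈ xs → length (f x) ≡ c) →
  length (concatMap f xs) ≡ length xs * c
length-concatMap f c [] _ = refl
length-concatMap f c (x ∷ xs) h = trans (length-++ (f x)) (cong₂ _+_ (h (here refl)) (length-concatMap f c xs (h ∘ there)))

insert : ∀ {A : Set} → ℕ → A → List A → List A
insert zero x σ = x ∷ σ
insert (suc i) x [] = x ∷ []
insert (suc i) x (y ∷ σ) = y ∷ insert i x σ

insert-↭ : ∀ {A : Set} i (x : A) σ → insert i x σ ↭ x ∷ σ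
insert-↭ zero x σ = ↭-refl
insert-↭ (suc i) x [] = ↭-refl
insert-↭ (suc i) x (y ∷ σ) = ↭-trans (prep y (insert-↭ i x σ)) (swap y x ↭-refl)

insert-split : ∀ {A : Set} (xs : List A) x ys → xs ++ x ∷ ys ≡ insert (length xs) x (xs ++ ys)
insert-split [] x ys = refl
insert-split (a ∷ xs) x ys = cong (a ∷_) (insert-split xs x ys)

insert-injective : ∀ {A : Set} i j (x : A) σ τ → x ∉ σ → x ∉ τ → i ≤ length σ → j ≤ length τ →
  insert i x σ ≡ insert j x τ → i ≡ j × σ ≡ τ
insert-injective zero zero x σ τ _ _ _ _ refl = refl , refl
insert-injective zero (suc j) x σ (y ∷ τ) _ x∉τ _ _ eq = ⊥-elim (x∉τ (here (proj₁ (∷-injective eq))))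
insert-injective (suc i) zero x (y ∷ σ) τ x∉σ _ _ _ eq = ⊥-elim (x∉σ (here (sym (proj₁ (∷-injective eq)))))
insert-injective (suc i) (suc j) x (y ∷ σ) (y′ ∷ τ) x∉σ x∉τ (s≤s i≤) (s≤s j≤) eq with ∷-injective eq
... | refl , eq′ with insert-injective i j x σ τ (x∉σ ∘ there) (x∉τ ∘ there) i≤ j≤ eq′
... | refl , refl = refl , refl

insertions : ∀ {A : Set} → A → List A → List (List A)
insertions x σ = applyUpTo (λ i → insert i x σ) (suc (length σ))

permutations : ∀ {A : Set} → List A → List (List A)
permutations [] = [] ∷ []
permutations (x ∷ S) = concatMap (insertions x) (permutations S)

permutations-sound : ∀ {A : Set} (S : List A) {π} → π ∈ permutations S → π ↭ S
permutations-sound [] (here refl) = ↭-refl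
permutations-sound (x ∷ S) π∈ with ∈-concatMap⁻′ (insertions x) (permutations S) π∈
... | σ , σ∈ , π∈ins with ∈-applyUpTo⁻ (λ i → insert i x σ) π∈ins
... | i , _ , refl = ↭-trans (insert-↭ i x σ) (prep x (permutations-sound S σ∈))

permutations-complete : ∀ {A : Set} (S : List A) {π} → π ↭ S → π ∈ permutations S
permutations-complete [] {[]} _ = here refl
permutations-complete [] {_ ∷ _} π↭ with ↭-length π↭
... | ()
permutations-complete (x ∷ S) {π} π↭ with ∈-∃++ (∈-resp-↭ (↭-sym π↭) (here refl))
... | A , B , refl = ∈-concatMap⁺′ (insertions x) (permutations S) (permutations-complete S AB↭S)
      (subst (_∈ insertions x (A ++ B)) (sym (insert-split A x B)) (∈-applyUpTo⁺ (λ i → insert i x (A ++ B)) (s≤s lenA)))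
  where
  AB↭S : A ++ B ↭ S
  AB↭S = drop-mid A [] π↭
  lenA : length A ≤ length (A ++ B)
  lenA = subst (length A ≤_) (sym (length-++ A)) (m≤m+n (length A) (length B))

permutations-unique : ∀ {A : Set} (S : List A) → Unique S → Unique (permutations S)
permutations-unique [] _ = [] ∷ []
permutations-unique (x ∷ S) (x∉S ∷ u) =
  Unique-concatMap (insertions x) (permutations-unique S u) insertionsUnique disjoint
  where
  x∉ : ∀ {σ} → σ ∈ permutations S → x ∉ σ
  x∉ σ∈ x∈σ = All.lookup x∉S (∈-resp-↭ (permutations-sound S σ∈) x∈σ) refl
  insertionsUnique : ∀ {σ} → σ ∈ permutations S → Unique (insertions x σ)
  insertionsUnique σ∈ = Uniqueₚ.applyUpTo⁺₁ _ _
    (λ i<j j≤ eq → <-irrefl (proj₁ (insert-injective _ _ x _ _ (x∉ σ∈) (x∉ σ∈) (<⇒≤ (≤-trans i<j (≤-pred j≤))) (≤-pred j≤) eq)) i<j)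
  disjoint : ∀ {σ τ π} → σ ∈ permutations S → τ ∈ permutations S → π ∈ insertions x σ → π ∈ insertions x τ → σ ≡ τ
  disjoint {σ} {τ} σ∈ τ∈ π∈σ π∈τ with ∈-applyUpTo⁻ (λ i → insert i x σ) π∈σ | ∈-applyUpTo⁻ (λ j → insert j x τ) π∈τ
  ... | i , i< , eq₁ | j , j< , eq₂ = proj₂ (insert-injective i j x σ τ (x∉ σ∈) (x∉ τ∈) (≤-pred i<) (≤-pred j<) (trans (sym eq₁) eq₂))

permutations-length : ∀ {A : Set} (S : List A) → length (permutations S) ≡ length S !
permutations-length [] = refl
permutations-length (x ∷ S) = begin
  length (concatMap (insertions x) (permutations S))  ≡⟨ length-concatMap _ (suc (length S)) (permutations S) lengthIns ⟩
  length (permutations S) * suc (length S)           ≡⟨ cong (_* suc (length S)) (permutations-length S) ⟩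
  length S ! * suc (length S)                        ≡⟨ *-comm (length S !) (suc (length S)) ⟩
  suc (length S) * length S !                        ∎
  where
  open ≡-Reasoning
  lengthIns : ∀ {σ} → σ ∈ permutations S → length (insertions x σ) ≡ suc (length S)
  lengthIns {σ} σ∈ = trans (length-applyUpTo (λ i → insert i x σ) (suc (length σ))) (cong suc (↭-length (permutations-sound S σ∈)))

Unique-sameMembers-length : ∀ {A : Set} {xs ys : List A} → Unique xs → Unique ys →
  (∀ x → (x ∈ xs) ⇔ (x ∈ ys)) → length xs ≡ length ys
Unique-sameMembers-length u v same = ↭-length (∼bag⇒↭ (unique∧set⇒bag u v (λ {x} → same x)))

concatMap-concatMap : ∀ {A B C : Set} (F : B → List C) (G : A → List B) xs →
  concatMap F (concatMap G xs) ≡ concatMap (concatMap F ∘ G) xs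
concatMap-concatMap F G [] = refl
concatMap-concatMap F G (x ∷ xs) = trans (concatMap-++ F (G x) (concatMap G xs)) (cong (concatMap F (G x) ++_) (concatMap-concatMap F G xs))

Σ< : ℕ → (ℕ → ℕ) → ℕ
Σ< zero f = 0
Σ< (suc n) f = f 0 + Σ< n (f ∘ suc)

Σ<-cong : ∀ n {f g : ℕ → ℕ} → (∀ i → i < n → f i ≡ g i) → Σ< n f ≡ Σ< n g
Σ<-cong zero _ = refl
Σ<-cong (suc n) f≗g = cong₂ _+_ (f≗g 0 (s≤s z≤n)) (Σ<-cong n (λ i i<n → f≗g (suc i) (s≤s i<n)))

Σ<-+ : ∀ n (f g : ℕ → ℕ) → Σ< n (λ i → f i + g i) ≡ Σ< n f + Σ< n g
Σ<-+ zero f g = refl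
Σ<-+ (suc n) f g = trans (cong (f 0 + g 0 +_) (Σ<-+ n (f ∘ suc) (g ∘ suc))) (interchange +-commutativeSemigroup (f 0) (g 0) _ _)

Σ<-const : ∀ n c → Σ< n (λ _ → c) ≡ n * c
Σ<-const zero c = refl
Σ<-const (suc n) c = cong (c +_) (Σ<-const n c)

indicator : Bool → ℕ
indicator true = 1
indicator false = 0

count : ∀ {A : Set} → (A → Bool) → List A → ℕ
count f [] = 0
count f (x ∷ xs) = indicator (f x) + count f xs

count-++ : ∀ {A : Set} (f : A → Bool) xs ys → count f (xs ++ ys) ≡ count f xs + count f ys
count-++ f [] ys = refl
count-++ f (x ∷ xs) ys = trans (cong (indicator (f x) +_) (count-++ f xs ys)) (sym (+-assoc (indicator (f x)) _ _))

count-filter : ∀ {A : Set} {P : A → Set} (P? : ∀ x → Dec (P x)) xs → length (filter P? xs) ≡ count (λ x → does (P? x)) xs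
count-filter P? [] = refl
count-filter P? (x ∷ xs) with P? x
... | yes _ = cong suc (count-filter P? xs)
... | no _ = count-filter P? xs

count-split : ∀ {A : Set} (f g : A → Bool) xs → count (λ x → f x ∧ not (g x)) xs + count (λ x → f x ∧ g x) xs ≡ count f xs
count-split f g [] = refl
count-split f g (x ∷ xs) with f x | g x
... | true | true = trans (+-suc (count _ xs) (count _ xs)) (cong suc (count-split f g xs))
... | true | false = cong suc (count-split f g xs)
... | false | _ = count-split f g xs

count-applyUpTo : ∀ {A : Set} (f : A → Bool) (g : ℕ → A) n → count f (applyUpTo g n) ≡ Σ< n (λ i → indicator (f (g i)))
count-applyUpTo f g zero = refl
count-applyUpTo f g (suc n) = cong (indicator (f (g 0)) +_) (count-applyUpTo f (g ∘ suc) n)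

count-concatMap-applyUpTo : ∀ {A B : Set} (f : B → Bool) (F : A → List B) (g : ℕ → A) n →
  count f (concatMap F (applyUpTo g n)) ≡ Σ< n (λ j → count f (F (g j)))
count-concatMap-applyUpTo f F g zero = refl
count-concatMap-applyUpTo f F g (suc n) =
  trans (count-++ f (F (g 0)) _) (cong (count f (F (g 0)) +_) (count-concatMap-applyUpTo f F (g ∘ suc) n))

count-concatMap-const : ∀ {A B : Set} (f : B → Bool) (F : A → List B) xs c →
  (∀ {x} → x ∈ xs → count f (F x) ≡ c) → count f (concatMap F xs) ≡ length xs * c
count-concatMap-const f F [] c _ = refl
count-concatMap-const f F (x ∷ xs) c h =
  trans (count-++ f (F x) _) (cong₂ _+_ (h (here refl)) (count-concatMap-const f F xs c (h ∘ there)))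

accepted? : ∀ s → Dec (s ≡ good)
accepted? good = yes refl
accepted? start = no (λ ())
accepted? saw2 = no (λ ())
accepted? dead = no (λ ())

isGood : State → Bool
isGood s = does (accepted? s)

accepts : List ℕ → Bool
accepts π = isGood (run start true π)

flips : ℕ → Bool → Bool
flips zero q = q
flips (suc i) q = flips i (not q)

-- Entries above 2 only shift the parity at which 1 is read.
run-insert1 : ∀ s q i σ → All (2 <_) σ → i ≤ length σ → run s q (insert i 1 σ) ≡ step s (flips i q) one
run-insert1 s q zero σ above _ = run-above2 (step s q one) (not q) σ above
run-insert1 s q (suc i) (y ∷ σ) (2<y ∷ above) (s≤s i≤) rewrite letter-big 2<y = run-insert1 s (not q) i σ above i≤

finalState : Bool → ℕ → ℕ → State
finalState p zero j = step start p one
finalState p (suc i) zero = step (step start p two) (flips i (not p)) one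
finalState p (suc i) (suc j) = finalState (not p) i j

run-insert12 : ∀ p i j σ → All (2 <_) σ → i ≤ suc (length σ) → j ≤ length σ →
  run start p (insert i 1 (insert j 2 σ)) ≡ finalState p i j
run-insert12 true zero j σ _ _ _ = run-good false (insert j 2 σ)
run-insert12 false zero j σ _ _ _ = run-dead true (insert j 2 σ)
run-insert12 p (suc i) zero σ above (s≤s i≤) _ = run-insert1 (step start p two) (not p) i σ above i≤
run-insert12 p (suc i) (suc j) (y ∷ σ) (2<y ∷ above) (s≤s i≤) (s≤s j≤) rewrite letter-big 2<y =
  run-insert12 (not p) i j σ above i≤ j≤

length-insert : ∀ {A : Set} i (x : A) σ → length (insert i x σ) ≡ suc (length σ)
length-insert i x σ = ↭-length (insert-↭ i x σ)

goodPairs : Bool → ℕ → ℕ → ℕ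
goodPairs p a b = Σ< a (λ j → Σ< b (λ i → indicator (isGood (finalState p i j))))

-- Hence, for σ above 2, the accepted words among all insertions of 2 and
-- then 1 into σ are counted by goodPairs, independently of σ.
acceptedInsertions : ∀ σ → All (2 <_) σ →
  count accepts (concatMap (insertions 1) (insertions 2 σ)) ≡ goodPairs true (suc (length σ)) (suc (suc (length σ)))
acceptedInsertions σ above =
  trans (count-concatMap-applyUpTo accepts (insertions 1) (λ j → insert j 2 σ) (suc (length σ)))
        (Σ<-cong (suc (length σ)) perPosition)
  where
  perPosition : ∀ j → j < suc (length σ) →
    count accepts (insertions 1 (insert j 2 σ)) ≡ Σ< (suc (suc (length σ))) (λ i → indicator (isGood (finalState true i j)))
  perPosition j (s≤s j≤) = begin
    count accepts (insertions 1 (insert j 2 σ))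
      ≡⟨ count-applyUpTo accepts (λ i → insert i 1 (insert j 2 σ)) (suc (length (insert j 2 σ))) ⟩
    Σ< (suc (length (insert j 2 σ))) (λ i → indicator (accepts (insert i 1 (insert j 2 σ))))
      ≡⟨ cong (λ n → Σ< (suc n) (λ i → indicator (accepts (insert i 1 (insert j 2 σ))))) (length-insert j 2 σ) ⟩
    Σ< (suc (suc (length σ))) (λ i → indicator (accepts (insert i 1 (insert j 2 σ))))
      ≡⟨ Σ<-cong (suc (suc (length σ))) (λ i i< → cong (indicator ∘ isGood) (run-insert12 true i j σ above (≤-pred i<) j≤)) ⟩
    Σ< (suc (suc (length σ))) (λ i → indicator (isGood (finalState true i j))) ∎
    where open ≡-Reasoning

goodPairs-step : ∀ p a b → goodPairs p (suc a) (suc b) ≡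
  suc a * indicator (isGood (step start p one))
  + (Σ< b (λ i → indicator (isGood (step (step start p two) (flips i (not p)) one))) + goodPairs (not p) a b)
goodPairs-step p a b =
  trans (Σ<-+ (suc a) (λ _ → first) (λ j → Σ< b (λ i → indicator (isGood (finalState p (suc i) j)))))
        (cong (_+ rest) (Σ<-const (suc a) first))
  where
  first = indicator (isGood (step start p one))
  rest = Σ< b (λ i → indicator (isGood (step (step start p two) (flips i (not p)) one))) + goodPairs (not p) a b

-- Into a word of length a − 1, 2 is inserted at one of a indices and then
-- 1 at one of a + 1; accepting counts the good choices from parity true.
accepting : ℕ → ℕ
accepting a = goodPairs true a (suc a)

accepting′ : ℕ → ℕ
accepting′ a = goodPairs false a (suc a)

-- The number of even i < b (when q = true).
evens : Bool → ℕ → ℕ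
evens q b = Σ< b (λ i → indicator (flips i q))

-- Started at parity true, 1 is accepted at index 0 for every index of 2,
-- and never after 2 at index 0; at parity false it is the other way round.
accepting-suc : ∀ a → accepting (suc a) ≡ suc a + accepting′ a
accepting-suc a = begin
  accepting (suc a)                                    ≡⟨ goodPairs-step true a (suc a) ⟩
  suc a * 1 + (Σ< (suc a) (λ _ → 0) + accepting′ a)     ≡⟨ cong₂ _+_ (*-identityʳ (suc a)) (cong (_+ accepting′ a) noneAfter2) ⟩
  suc a + accepting′ a                                 ∎
  where
  open ≡-Reasoning
  noneAfter2 : Σ< (suc a) (λ _ → 0) ≡ 0
  noneAfter2 = trans (Σ<-const (suc a) 0) (*-zeroʳ (suc a))

accepting′-suc : ∀ a → accepting′ (suc a) ≡ evens true (suc a) + accepting a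
accepting′-suc a = begin
  accepting′ (suc a)                       ≡⟨ goodPairs-step false a (suc a) ⟩
  suc a * 0 + (afterTwo + accepting a)     ≡⟨ cong (_+ (afterTwo + accepting a)) (*-zeroʳ (suc a)) ⟩
  afterTwo + accepting a                   ≡⟨ cong (_+ accepting a) (Σ<-cong (suc a) (λ i _ → saw2-one (flips i true))) ⟩
  evens true (suc a) + accepting a         ∎
  where
  open ≡-Reasoning
  afterTwo = Σ< (suc a) (λ i → indicator (isGood (step saw2 (flips i true) one)))
  saw2-one : ∀ q → indicator (isGood (step saw2 q one)) ≡ indicator q
  saw2-one true = refl
  saw2-one false = refl

evens-double : ∀ t → evens true (t + t) ≡ t
evens-double zero = refl
evens-double (suc t) = cong suc (trans (cong (evens false) (+-suc t t)) (evens-double t))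

evens-odd : ∀ t → evens true (suc (t + t)) ≡ suc t
evens-odd t = cong suc (evens-false t)
  where
  evens-false : ∀ t → evens false (t + t) ≡ t
  evens-false zero = refl
  evens-false (suc t) = trans (cong (evens true) (+-suc t t)) (cong suc (evens-false t))

accepting-suc-suc : ∀ a → accepting (suc (suc a)) ≡ suc (suc a) + (evens true (suc a) + accepting a)
accepting-suc-suc a = trans (accepting-suc (suc a)) (cong (suc (suc a) +_) (accepting′-suc a))

even-step : ∀ k y → 2 * y ≡ 3 * k * (k + 1) → 2 * (suc (suc (k + k)) + (suc k + y)) ≡ 3 * suc k * (suc k + 1)
even-step k y h = begin
  2 * (suc (suc (k + k)) + (suc k + y))  ≡⟨ expand k y ⟩
  6 * (k + 1) + 2 * y                    ≡⟨ cong (6 * (k + 1) +_) h ⟩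
  6 * (k + 1) + 3 * k * (k + 1)          ≡⟨ collect k ⟩
  3 * suc k * (suc k + 1)                ∎
  where
  open ≡-Reasoning
  expand : ∀ k y → 2 * (suc (suc (k + k)) + (suc k + y)) ≡ 6 * (k + 1) + 2 * y
  expand = solve-∀
  collect : ∀ k → 6 * (k + 1) + 3 * k * (k + 1) ≡ 3 * suc k * (suc k + 1)
  collect = solve-∀

odd-step : ∀ k y → 2 * y ≡ (k + 1) * (3 * k + 2) → 2 * (suc (suc (suc (k + k))) + (suc k + y)) ≡ (suc k + 1) * (3 * suc k + 2)
odd-step k y h = begin
  2 * (suc (suc (suc (k + k))) + (suc k + y))  ≡⟨ expand k y ⟩
  6 * k + 8 + 2 * y                            ≡⟨ cong (6 * k + 8 +_) h ⟩
  6 * k + 8 + (k + 1) * (3 * k + 2)            ≡⟨ collect k ⟩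
  (suc k + 1) * (3 * suc k + 2)                ∎
  where
  open ≡-Reasoning
  expand : ∀ k y → 2 * (suc (suc (suc (k + k))) + (suc k + y)) ≡ 6 * k + 8 + 2 * y
  expand = solve-∀
  collect : ∀ k → 6 * k + 8 + (k + 1) * (3 * k + 2) ≡ (suc k + 1) * (3 * suc k + 2)
  collect = solve-∀

accepting-even : ∀ k → 2 * accepting (k + k) ≡ 3 * k * (k + 1)
accepting-even zero = refl
accepting-even (suc k) = begin
  2 * accepting (suc k + suc k)        ≡⟨ cong (λ t → 2 * accepting (suc t)) (+-suc k k) ⟩
  2 * accepting (suc (suc (k + k)))    ≡⟨ cong (2 *_) (accepting-suc-suc (k + k)) ⟩
  2 * (suc (suc (k + k)) + (evens true (suc (k + k)) + accepting (k + k)))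
    ≡⟨ cong (λ e → 2 * (suc (suc (k + k)) + (e + accepting (k + k)))) (evens-odd k) ⟩
  2 * (suc (suc (k + k)) + (suc k + accepting (k + k)))  ≡⟨ even-step k (accepting (k + k)) (accepting-even k) ⟩
  3 * suc k * (suc k + 1)              ∎
  where open ≡-Reasoning

accepting-odd : ∀ k → 2 * accepting (suc (k + k)) ≡ (k + 1) * (3 * k + 2)
accepting-odd zero = refl
accepting-odd (suc k) = begin
  2 * accepting (suc (suc k + suc k))        ≡⟨ cong (λ t → 2 * accepting (suc (suc t))) (+-suc k k) ⟩
  2 * accepting (suc (suc (suc (k + k))))    ≡⟨ cong (2 *_) (accepting-suc-suc (suc (k + k))) ⟩
  2 * (suc (suc (suc (k + k))) + (evens true (suc (suc (k + k))) + accepting (suc (k + k))))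
    ≡⟨ cong (λ e → 2 * (suc (suc (suc (k + k))) + (e + accepting (suc (k + k)))))
            (trans (cong (evens true) (sym (+-suc (suc k) k))) (evens-double (suc k))) ⟩
  2 * (suc (suc (suc (k + k))) + (suc k + accepting (suc (k + k))))  ≡⟨ odd-step k _ (accepting-odd k) ⟩
  (suc k + 1) * (3 * suc k + 2)              ∎
  where open ≡-Reasoning

-- The accepted permutations of 1 ∷ 2 ∷ S, for S above 2: every
-- arrangement of S, each with the same number of good positions of 1 and 2.
acceptedCount : ∀ S → All (2 <_) S → count accepts (permutations (1 ∷ 2 ∷ S)) ≡ length S ! * accepting (suc (length S))
acceptedCount S above = begin
  count accepts (concatMap (insertions 1) (concatMap (insertions 2) (permutations S)))
    ≡⟨ cong (count accepts) (concatMap-concatMap (insertions 1) (insertions 2) (permutations S)) ⟩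
  count accepts (concatMap (concatMap (insertions 1) ∘ insertions 2) (permutations S))
    ≡⟨ count-concatMap-const accepts _ (permutations S) (accepting (suc (length S))) perArrangement ⟩
  length (permutations S) * accepting (suc (length S))
    ≡⟨ cong (_* accepting (suc (length S))) (permutations-length S) ⟩
  length S ! * accepting (suc (length S)) ∎
  where
  open ≡-Reasoning
  perArrangement : ∀ {σ} → σ ∈ permutations S → count accepts (concatMap (insertions 1) (insertions 2 σ)) ≡ accepting (suc (length S))
  perArrangement {σ} σ∈ = trans (acceptedInsertions σ (All-resp-↭ (↭-sym σ↭S) above)) (cong (accepting ∘ suc) (↭-length σ↭S))
    where
    σ↭S = permutations-sound S σ∈

ExceptionalOrEmpty : List ℕ → Set
ExceptionalOrEmpty σ = σ ≡ [] ⊎ Exceptional σ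

ExceptionalOrEmpty-even : ∀ {σ} → ExceptionalOrEmpty σ → isEven (length σ) ≡ true
ExceptionalOrEmpty-even (inj₁ refl) = refl
ExceptionalOrEmpty-even (inj₂ ex) = Exceptional-even ex

exceptional-least : ∀ {ρ m} → Exceptional ρ → m ∈ ρ → All (m ≤_) ρ →
  Σ[ σ ∈ List ℕ ] Σ[ b ∈ ℕ ] (ρ ≡ σ ++ m ∷ b ∷ []) × m < b × ExceptionalOrEmpty σ
exceptional-least (pair {b = b} m<b) (here refl) _ = [] , b , refl , m<b , inj₁ refl
exceptional-least (pair a<m) (there (here refl)) (m≤a ∷ _) = ⊥-elim (<-irrefl refl (≤-trans a<m m≤a))
exceptional-least (extend _ c<m _) (here refl) (_ ∷ _ ∷ m≤c ∷ _) = ⊥-elim (<-irrefl refl (≤-trans c<m m≤c))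
exceptional-least (extend a<m _ _) (there (here refl)) (m≤a ∷ _) = ⊥-elim (<-irrefl refl (≤-trans a<m m≤a))
exceptional-least {a ∷ b ∷ c ∷ d ∷ r} (extend a<b c<a ex) (there (there m∈)) (_ ∷ _ ∷ le)
  with exceptional-least ex m∈ le
... | σ , b′ , eq , m<b′ , inj₁ refl = a ∷ b ∷ [] , b′ , cong (λ t → a ∷ b ∷ t) eq , m<b′ , inj₂ (pair a<b)
... | σ , b′ , eq , m<b′ , inj₂ exσ = a ∷ b ∷ σ , b′ , cong (λ t → a ∷ b ∷ t) eq , m<b′ , inj₂ (prepend σ exσ eq)
  where
  prepend : ∀ σ → Exceptional σ → c ∷ d ∷ r ≡ σ ++ _ ∷ b′ ∷ [] → Exceptional (a ∷ b ∷ σ)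
  prepend (x ∷ y ∷ []) (pair x<y) eq′ with ∷-injective eq′
  ... | refl , _ = extend a<b c<a (pair x<y)
  prepend (x ∷ y ∷ z ∷ w ∷ s) exσ eq′ with ∷-injective eq′
  ... | refl , _ = extend a<b c<a exσ

picks : ∀ {A : Set} → List A → List (A × List A)
picks [] = []
picks (x ∷ xs) = (x , xs) ∷ map (λ (b , r) → b , x ∷ r) (picks xs)

private
  ∈-picks-there : ∀ {A : Set} {x b : A} {r : List A} ps → (b , r) ∈ map (λ (b , r) → b , x ∷ r) ps →
    Σ[ r′ ∈ List A ] (r ≡ x ∷ r′) × (b , r′) ∈ ps
  ∈-picks-there (p ∷ ps) (here refl) = proj₂ p , refl , here refl
  ∈-picks-there (p ∷ ps) (there m) with ∈-picks-there ps m
  ... | r′ , eq , m′ = r′ , eq , there m′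

picks-↭ : ∀ {A : Set} (S : List A) {b r} → (b , r) ∈ picks S → S ↭ b ∷ r
picks-↭ (x ∷ xs) (here refl) = ↭-refl
picks-↭ (x ∷ xs) {b} (there m) with ∈-picks-there (picks xs) m
... | r′ , refl , m′ = ↭-trans (prep x (picks-↭ xs m′)) (swap x b ↭-refl)

picks-complete : ∀ {A : Set} (S : List A) {b} → b ∈ S → Σ[ r ∈ List A ] (b , r) ∈ picks S
picks-complete (x ∷ xs) (here refl) = xs , here refl
picks-complete (x ∷ xs) (there b∈) with picks-complete xs b∈
... | r , m = x ∷ r , there (∈-map⁺ (λ (b , r) → b , x ∷ r) m)

picks-determined : ∀ {A : Set} (S : List A) → Unique S → ∀ {b r r′} → (b , r) ∈ picks S → (b , r′) ∈ picks S → r ≡ r′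
picks-determined (x ∷ xs) u (here refl) (here refl) = refl
picks-determined (x ∷ xs) (x∉ ∷ u) (here refl) (there m) with ∈-picks-there (picks xs) m
... | _ , _ , m′ = ⊥-elim (All.lookup x∉ (∈-resp-↭ (↭-sym (picks-↭ xs m′)) (here refl)) refl)
picks-determined (x ∷ xs) (x∉ ∷ u) (there m) (here refl) with ∈-picks-there (picks xs) m
... | _ , _ , m′ = ⊥-elim (All.lookup x∉ (∈-resp-↭ (↭-sym (picks-↭ xs m′)) (here refl)) refl)
picks-determined (x ∷ xs) (x∉ ∷ u) (there m) (there m₂) with ∈-picks-there (picks xs) m | ∈-picks-there (picks xs) m₂
... | _ , refl , m′ | _ , refl , m₂′ = cong (x ∷_) (picks-determined xs u m′ m₂′)

picks-length : ∀ {A : Set} (S : List A) → length (picks S) ≡ length S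
picks-length [] = refl
picks-length (x ∷ xs) = cong suc (trans (length-map _ (picks xs)) (picks-length xs))

picks-increasing : ∀ S → AllPairs _<_ S → ∀ {b r} → (b , r) ∈ picks S → AllPairs _<_ r
picks-increasing (x ∷ xs) (_ ∷ inc) (here refl) = inc
picks-increasing (x ∷ xs) (x< ∷ inc) (there m) with ∈-picks-there (picks xs) m
... | r′ , refl , m′ with All-resp-↭ (picks-↭ xs m′) x<
... | _ ∷ x<r′ = x<r′ ∷ picks-increasing xs inc m′

-- The exceptional arrangements of an increasing list s ∷ S: its least entry
-- s opens the last pair s b; before it comes an exceptional arrangement of
-- the rest.  The first argument bounds the recursion depth.
exceptionals : ℕ → List ℕ → List (List ℕ)
exceptionals zero S = [] ∷ []
exceptionals (suc f) [] = [] ∷ []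
exceptionals (suc f) (s ∷ S) = concatMap (λ (b , r) → map (_++ s ∷ b ∷ []) (exceptionals f r)) (picks S)

private
  ∈-map-snoc2 : ∀ {s b : ℕ} {τ} xs → τ ∈ map (_++ s ∷ b ∷ []) xs → Σ[ σ ∈ List ℕ ] (τ ≡ σ ++ s ∷ b ∷ []) × σ ∈ xs
  ∈-map-snoc2 {s} {b} xs τ∈ with ∈-map⁻ (_++ s ∷ b ∷ []) τ∈
  ... | σ , σ∈ , eq = σ , eq , σ∈

  rest-length : ∀ {A : Set} {f} {S : List A} {b r} → length S ≤ suc f → (b , r) ∈ picks S → length r ≤ f
  rest-length {S = S} le m = ≤-pred (≤-trans (≤-reflexive (sym (↭-length (picks-↭ S m)))) le)

exceptionals-sound : ∀ f S → AllPairs _<_ S → length S ≤ f → ∀ {τ} → τ ∈ exceptionals f S → (τ ↭ S) × ExceptionalOrEmpty τ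
exceptionals-sound zero [] _ _ (here refl) = ↭-refl , inj₁ refl
exceptionals-sound (suc f) [] _ _ (here refl) = ↭-refl , inj₁ refl
exceptionals-sound (suc f) (s ∷ S) (s< ∷ inc) (s≤s le) τ∈
  with ∈-concatMap⁻′ (λ (b , r) → map (_++ s ∷ b ∷ []) (exceptionals f r)) (picks S) τ∈
... | (b , r) , pick , τ∈′ with ∈-map-snoc2 (exceptionals f r) τ∈′
... | σ , refl , σ∈ with exceptionals-sound f r (picks-increasing S inc pick) (rest-length (m≤n⇒m≤1+n le) pick) σ∈
... | σ↭r , exσ = ↭-trans (↭-trans (++⁺ʳ (s ∷ b ∷ []) σ↭r) (++-comm r (s ∷ b ∷ []))) (prep s (↭-sym (picks-↭ S pick)))
                  , inj₂ (close exσ)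
  where
  s<br : All (s <_) (b ∷ r)
  s<br = All-resp-↭ (picks-↭ S pick) s<
  close : ExceptionalOrEmpty σ → Exceptional (σ ++ s ∷ b ∷ [])
  close (inj₁ refl) = pair (All.head s<br)
  close (inj₂ ex) = Exceptional-snoc σ ex (All-resp-↭ (↭-sym σ↭r) (All.tail s<br)) (All.head s<br)

exceptionals-complete : ∀ f S → AllPairs _<_ S → length S ≤ f → ∀ {τ} → τ ↭ S → ExceptionalOrEmpty τ → τ ∈ exceptionals f S
exceptionals-complete zero [] _ _ {[]} _ _ = here refl
exceptionals-complete (suc f) [] _ _ {[]} _ _ = here refl
exceptionals-complete f [] _ _ {_ ∷ _} τ↭ _ with ↭-length τ↭
... | ()
exceptionals-complete zero (s ∷ S) _ () _ _
exceptionals-complete (suc f) (s ∷ S) _ _ {[]} τ↭ _ with ↭-length τ↭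
... | ()
exceptionals-complete (suc f) (s ∷ S) _ _ {_ ∷ _} _ (inj₁ ())
exceptionals-complete (suc f) (s ∷ S) (s< ∷ inc) (s≤s le) {τ} τ↭ (inj₂ ex)
  with exceptional-least ex (∈-resp-↭ (↭-sym τ↭) (here refl)) (All-resp-↭ (↭-sym τ↭) (≤-refl ∷ All.map <⇒≤ s<))
... | σ , b , refl , s<b , exσ with ∈-resp-↭ τ↭ (∈-++⁺ʳ σ (there (here refl)))
... | here b≡s = ⊥-elim (<-irrefl (sym b≡s) s<b)
... | there b∈S with picks-complete S b∈S
... | r , pick = ∈-concatMap⁺′ (λ (b , r) → map (_++ s ∷ b ∷ []) (exceptionals f r)) (picks S) pick
                   (∈-map⁺ (_++ s ∷ b ∷ []) σ∈)
  where
  σ↭r : σ ↭ r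
  σ↭r = subst (_↭ r) (++-identityʳ σ) (drop-mid σ [] (drop-mid σ [] (↭-trans τ↭ (prep s (picks-↭ S pick)))))
  σ∈ : σ ∈ exceptionals f r
  σ∈ = exceptionals-complete f r (picks-increasing S inc pick) (rest-length (m≤n⇒m≤1+n le) pick) σ↭r exσ

exceptionals-unique : ∀ f S → Unique S → Unique (exceptionals f S)
exceptionals-unique zero S _ = [] ∷ []
exceptionals-unique (suc f) [] _ = [] ∷ []
exceptionals-unique (suc f) (s ∷ S) (_ ∷ u) =
  Unique-concatMap (λ (b , r) → map (_++ s ∷ b ∷ []) (exceptionals f r)) (picks-unique S u) perPick disjoint
  where
  picks-unique : ∀ S → Unique S → Unique (picks S)
  picks-unique [] _ = []
  picks-unique (x ∷ xs) (x∉ ∷ u) =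
    All.tabulate (λ {p} m eq → notFirst m eq) ∷ Uniqueₚ.map⁺ (λ {p} {q} → injective p q) (picks-unique xs u)
    where
    notFirst : ∀ {p} → p ∈ map (λ (b , r) → b , x ∷ r) (picks xs) → (x , xs) ≢ p
    notFirst m refl with ∈-picks-there (picks xs) m
    ... | _ , _ , m′ = All.lookup x∉ (∈-resp-↭ (↭-sym (picks-↭ xs m′)) (here refl)) refl
    injective : ∀ (p q : ℕ × List ℕ) → (proj₁ p , x ∷ proj₂ p) ≡ (proj₁ q , x ∷ proj₂ q) → p ≡ q
    injective _ _ refl = refl
  perPick : ∀ {p} → p ∈ picks S → Unique (map (_++ s ∷ proj₁ p ∷ []) (exceptionals f (proj₂ p)))
  perPick {b , r} pick with Unique-resp-↭ u (picks-↭ S pick)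
  ... | _ ∷ ur = Uniqueₚ.map⁺ (λ {σ} {σ′} → ++-cancelʳ (s ∷ b ∷ []) σ σ′) (exceptionals-unique f r ur)
  lastEntry : ∀ (σ σ′ : List ℕ) {b b′} → σ ++ s ∷ b ∷ [] ≡ σ′ ++ s ∷ b′ ∷ [] → b ≡ b′
  lastEntry σ σ′ {b} {b′} eq = proj₁ (∷-injective (trans (sym (reverse-++ σ (s ∷ b ∷ []))) (trans (cong reverse eq) (reverse-++ σ′ (s ∷ b′ ∷ [])))))
  disjoint : ∀ {p q τ} → p ∈ picks S → q ∈ picks S → τ ∈ map (_++ s ∷ proj₁ p ∷ []) (exceptionals f (proj₂ p)) →
    τ ∈ map (_++ s ∷ proj₁ q ∷ []) (exceptionals f (proj₂ q)) → p ≡ q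
  disjoint {b , r} {b′ , r′} pick pick′ τ∈ τ∈′ with ∈-map-snoc2 (exceptionals f r) τ∈ | ∈-map-snoc2 (exceptionals f r′) τ∈′
  ... | σ , eq , _ | σ′ , eq′ , _ with lastEntry σ σ′ (trans (sym eq) eq′)
  ... | refl = cong (b ,_) (picks-determined S u pick pick′)

exceptionalCount : ℕ → ℕ
exceptionalCount zero = 1
exceptionalCount (suc zero) = 0
exceptionalCount (suc (suc n)) = suc n * exceptionalCount n

exceptionals-length : ∀ f S → length S ≤ f → length (exceptionals f S) ≡ exceptionalCount (length S)
exceptionals-length zero [] _ = refl
exceptionals-length (suc f) [] _ = refl
exceptionals-length zero (s ∷ S) ()
exceptionals-length (suc f) (s ∷ S) (s≤s le) with length S in lenS
... | zero = trans (length-concatMap _ 0 (picks S) (λ pick → ⊥-elim (noPick pick))) (*-zeroʳ (length (picks S)))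
  where
  noPick : ∀ {p} → p ∈ picks S → ⊥
  noPick pick with trans (sym lenS) (↭-length (picks-↭ S pick))
  ... | ()
... | suc n = trans (length-concatMap _ (exceptionalCount n) (picks S) perPick) (cong (_* exceptionalCount n) (trans (picks-length S) lenS))
  where
  perPick : ∀ {p} → p ∈ picks S → length (map (_++ s ∷ proj₁ p ∷ []) (exceptionals f (proj₂ p))) ≡ exceptionalCount n
  perPick {b , r} pick = trans (length-map _ (exceptionals f r))
    (trans (exceptionals-length f r (≤-trans (≤-reflexive lenr) (≤-trans (n≤1+n n) le))) (cong exceptionalCount lenr))
    where
    lenr : length r ≡ n
    lenr = suc-injective (trans (sym (↭-length (picks-↭ S pick))) lenS)

exceptionalCount-even : ∀ k → exceptionalCount (k + k) ≡ (k + k ∸ 1) !!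
exceptionalCount-even zero = refl
exceptionalCount-even (suc k) rewrite +-suc k k = trans (cong (suc (k + k) *_) (exceptionalCount-even k)) (sym (odd!! k))
  where
  odd!! : ∀ j → (suc (j + j)) !! ≡ suc (j + j) * ((j + j ∸ 1) !!)
  odd!! zero = refl
  odd!! (suc j) rewrite +-suc j j = refl

exceptionalCount-odd : ∀ k → exceptionalCount (suc (k + k)) ≡ 0
exceptionalCount-odd zero = refl
exceptionalCount-odd (suc k) rewrite +-suc k k = trans (cong (suc (suc (k + k)) *_) (exceptionalCount-odd k)) (*-zeroʳ (suc (suc (k + k))))

ι-increasing : ∀ n → AllPairs _<_ (ι n)
ι-increasing n = AllPairsₚ.map⁺ (AllPairsₚ.applyUpTo⁺₁ (λ i → i) n (λ i<j _ → s≤s i<j))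

ι-good : ∀ m → Good (ι (suc (suc (suc m))))
ι-good m = run-good false (drop 1 (ι (suc (suc (suc m))))) , notExceptional m
  where
  notExceptional : ∀ m → ¬ Exceptional (ι (suc (suc (suc m))))
  notExceptional zero ()
  notExceptional (suc m) (extend _ (s≤s ()) _)

-- An accepted exceptional word σ 1 b of distinct positive entries containing
-- 2 ends in 1 2: if 2 were in σ it would open the last pair of σ (being the
-- least entry of σ), at an odd position, which the automaton rejects.
acceptedExceptional-ends12 : ∀ σ b → Unique (σ ++ 1 ∷ b ∷ []) → All (1 ≤_) (σ ++ 1 ∷ b ∷ []) → 2 ∈ (σ ++ 1 ∷ b ∷ []) →
  run start true (σ ++ 1 ∷ b ∷ []) ≡ good → ExceptionalOrEmpty σ → b ≡ 2
acceptedExceptional-ends12 σ b u pos has2 accepted exσ with ∈-++⁻ σ has2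
... | inj₂ (here ())
... | inj₂ (there (here 2≡b)) = sym 2≡b
... | inj₂ (there (there ()))
... | inj₁ 2∈σ = ⊥-elim (twoInside exσ 2∈σ)
  where
  above1 : All (1 <_) σ
  above1 = Allₚ.++⁻ˡ σ (aboveMin σ pos u)
  twoInside : ExceptionalOrEmpty σ → 2 ∈ σ → ⊥
  twoInside (inj₁ refl) ()
  twoInside (inj₂ ex) 2∈σ with exceptional-least ex 2∈σ above1
  ... | σ″ , b′ , refl , _ , exσ″ with ExceptionalOrEmpty-even exσ″ | twoAtEvenPosition σ″ (b′ ∷ 1 ∷ b ∷ []) above2 accepted′
    where
    uσ : Unique (σ″ ++ 2 ∷ b′ ∷ [])
    uσ = Unique-++⁻ˡ (σ″ ++ 2 ∷ b′ ∷ []) u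
    above2 : All (2 <_) σ″
    above2 = All.zipWith (λ (1<x , 2≢x) → ≤∧≢⇒< 1<x 2≢x)
               (Allₚ.++⁻ˡ σ″ above1 , Allₚ.++⁻ˡ σ″ (Unique-mid σ″ uσ))
    accepted′ : run start true (σ″ ++ 2 ∷ b′ ∷ 1 ∷ b ∷ []) ≡ good
    accepted′ = subst (λ t → run start true t ≡ good) (++-assoc σ″ (2 ∷ b′ ∷ []) (1 ∷ b ∷ [])) accepted
  ... | even | odd with trans (sym even) odd
  ... | ()

module IdentityClass (m : ℕ) where
  n : ℕ
  n = suc (suc (suc m))

  S′ : List ℕ
  S′ = drop 2 (ι n)

  S′-increasing : AllPairs _<_ S′
  S′-increasing with ι-increasing n
  ... | _ ∷ _ ∷ inc = inc

  S′-above2 : All (2 <_) S′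
  S′-above2 with ι-increasing n
  ... | _ ∷ 2< ∷ _ = 2<

  S′-unique : Unique S′
  S′-unique = Unique-++⁻ʳ (1 ∷ 2 ∷ []) (ι-unique n)

  S′-length : length S′ ≡ suc m
  S′-length = suc-injective (suc-injective (trans (length-map suc (upTo n)) (length-applyUpTo (λ i → i) n)))

  good? : ∀ π → Dec (Good π)
  good? π = accepted? (run start true π) ×-dec ¬? (exceptional? π)

  acceptedExceptional? : ∀ π → Dec ((run start true π ≡ good) × Exceptional π)
  acceptedExceptional? π = accepted? (run start true π) ×-dec exceptional? π

  L : List (List ℕ)
  L = filter good? (permutations (ι n))

  L-unique : Unique L
  L-unique = Uniqueₚ.filter⁺ good? (permutations-unique (ι n) (ι-unique n))

  L-members : ∀ π → (π ∈ L) ⇔ (InS n π × π ≈ ι n)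
  L-members π = mk⇔ members⇒ members⇐
    where
    members⇒ : π ∈ L → InS n π × π ≈ ι n
    members⇒ π∈ with ∈-filter⁻ good? π∈
    ... | π∈perms , g = permutations-sound (ι n) π∈perms , complete m π (permutations-sound (ι n) π∈perms) g
    members⇐ : InS n π × π ≈ ι n → π ∈ L
    members⇐ (π↭ , π≈ι) = ∈-filter⁺ good? (permutations-complete (ι n) π↭) (Good-≈ (≈-sym π≈ι) (ι-positive n) (ι-good m))

  E : List (List ℕ)
  E = filter acceptedExceptional? (permutations (ι n))

  E-members : ∀ π → (π ∈ E) ⇔ (π ∈ map (_++ 1 ∷ 2 ∷ []) (exceptionals (suc m) S′))
  E-members π = mk⇔ members⇒ members⇐
    where
    members⇒ : π ∈ E → π ∈ map (_++ 1 ∷ 2 ∷ []) (exceptionals (suc m) S′)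
    members⇒ π∈ with ∈-filter⁻ acceptedExceptional? π∈
    ... | π∈perms , accepted , ex
      with permutations-sound (ι n) π∈perms
    ... | π↭ with exceptional-least ex (∈-resp-↭ (↭-sym π↭) (here refl)) (All-resp-↭ (↭-sym π↭) (ι-positive n))
    ... | σ , b , refl , _ , exσ
      with acceptedExceptional-ends12 σ b (Unique-resp-↭ (ι-unique n) (↭-sym π↭)) (All-resp-↭ (↭-sym π↭) (ι-positive n))
             (∈-resp-↭ (↭-sym π↭) (there (here refl))) accepted exσ
    ... | refl = ∈-map⁺ (_++ 1 ∷ 2 ∷ []) (exceptionals-complete (suc m) S′ S′-increasing (≤-reflexive S′-length) σ↭ exσ)
      where
      σ↭ : σ ↭ S′
      σ↭ = subst (_↭ S′) (++-identityʳ σ) (drop-mid σ [] (drop-mid σ [] π↭))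
    members⇐ : π ∈ map (_++ 1 ∷ 2 ∷ []) (exceptionals (suc m) S′) → π ∈ E
    members⇐ π∈ with ∈-map⁻ (_++ 1 ∷ 2 ∷ []) π∈
    ... | σ , σ∈ , refl with exceptionals-sound (suc m) S′ S′-increasing (≤-reflexive S′-length) σ∈
    ... | σ↭ , exσ = ∈-filter⁺ acceptedExceptional? (permutations-complete (ι n) σ12↭) (accepted , exceptional exσ)
      where
      σ12↭ : (σ ++ 1 ∷ 2 ∷ []) ↭ ι n
      σ12↭ = ↭-trans (++⁺ʳ (1 ∷ 2 ∷ []) σ↭) (++-comm S′ (1 ∷ 2 ∷ []))
      above2 : All (2 <_) σ
      above2 = All-resp-↭ (↭-sym σ↭) S′-above2
      exceptional : ExceptionalOrEmpty σ → Exceptional (σ ++ 1 ∷ 2 ∷ [])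
      exceptional (inj₁ refl) = pair (s≤s (s≤s z≤n))
      exceptional (inj₂ ex) = Exceptional-snoc σ ex (All.map <⇒≤ above2) (s≤s (s≤s z≤n))
      accepted : run start true (σ ++ 1 ∷ 2 ∷ []) ≡ good
      accepted = begin
        run start true (σ ++ 1 ∷ 2 ∷ [])                          ≡⟨ run-++ start true σ (1 ∷ 2 ∷ []) ⟩
        run (run start true σ) (parityAfter true σ) (1 ∷ 2 ∷ [])  ≡⟨ cong₂ (λ s q → run s q (1 ∷ 2 ∷ [])) (run-above2 start true σ above2)
                                                                           (trans (parityAfter-true σ) (ExceptionalOrEmpty-even exσ)) ⟩
        run start true (1 ∷ 2 ∷ [])                               ≡⟨⟩
        good                                                      ∎
        where open ≡-Reasoning

  E-length : length E ≡ exceptionalCount (suc m)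
  E-length = begin
    length E                                                         ≡⟨ Unique-sameMembers-length E-unique image-unique E-members ⟩
    length (map (_++ 1 ∷ 2 ∷ []) (exceptionals (suc m) S′))          ≡⟨ length-map _ (exceptionals (suc m) S′) ⟩
    length (exceptionals (suc m) S′)                                 ≡⟨ exceptionals-length (suc m) S′ (≤-reflexive S′-length) ⟩
    exceptionalCount (length S′)                                     ≡⟨ cong exceptionalCount S′-length ⟩
    exceptionalCount (suc m)                                         ∎
    where
    open ≡-Reasoning
    E-unique = Uniqueₚ.filter⁺ acceptedExceptional? (permutations-unique (ι n) (ι-unique n))
    image-unique = Uniqueₚ.map⁺ (λ {σ} {σ′} → ++-cancelʳ (1 ∷ 2 ∷ []) σ σ′) (exceptionals-unique (suc m) S′ S′-unique)

  -- Good = accepted and not exceptional, so |L| + |E| counts the accepted permutations.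
  L-length : length L + exceptionalCount (suc m) ≡ suc m ! * accepting (suc (suc m))
  L-length = begin
    length L + exceptionalCount (suc m)
      ≡⟨ cong₂ _+_ (count-filter good? (permutations (ι n))) (trans (sym E-length) (count-filter acceptedExceptional? (permutations (ι n)))) ⟩
    count (λ π → accepts π ∧ not (does (exceptional? π))) (permutations (ι n)) + count (λ π → accepts π ∧ does (exceptional? π)) (permutations (ι n))
      ≡⟨ count-split accepts (does ∘ exceptional?) (permutations (ι n)) ⟩
    count accepts (permutations (1 ∷ 2 ∷ S′))
      ≡⟨ acceptedCount S′ S′-above2 ⟩
    length S′ ! * accepting (suc (length S′))
      ≡⟨ cong (λ l → l ! * accepting (suc l)) S′-length ⟩
    suc m ! * accepting (suc (suc m)) ∎
    where
    open ≡-Reasoning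

∸-by : ∀ {a} b c → a ≡ c + b → a ∸ c ≡ b
∸-by b c refl = m+n∸m≡n c b

odd-formula : ∀ j ℓ → ℓ + exceptionalCount (suc (j + j)) ≡ suc (j + j) ! * accepting (suc (suc (j + j))) →
  2 * ℓ ≡ 3 * suc j * (suc j + 1) * ((2 * suc j ∸ 1) !)
odd-formula j ℓ count = begin
  2 * ℓ                                   ≡⟨ cong (2 *_) ℓ≡ ⟩
  2 * (F * A)                             ≡⟨ regroup F A ⟩
  F * (2 * A)                             ≡⟨ cong (λ t → F * (2 * accepting (suc t))) (sym (+-suc j j)) ⟩
  F * (2 * accepting (suc j + suc j))     ≡⟨ cong (F *_) (accepting-even (suc j)) ⟩
  F * (3 * suc j * (suc j + 1))           ≡⟨ *-comm F _ ⟩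
  3 * suc j * (suc j + 1) * F             ≡⟨ cong (λ t → 3 * suc j * (suc j + 1) * t !) (sym (∸-by _ 1 (double j))) ⟩
  3 * suc j * (suc j + 1) * ((2 * suc j ∸ 1) !) ∎
  where
  open ≡-Reasoning
  F = suc (j + j) !
  A = accepting (suc (suc (j + j)))
  ℓ≡ : ℓ ≡ F * A
  ℓ≡ = trans (sym (+-identityʳ ℓ)) (trans (cong (ℓ +_) (sym (exceptionalCount-odd j))) count)
  regroup : ∀ f a → 2 * (f * a) ≡ f * (2 * a)
  regroup = solve-∀
  double : ∀ j → 2 * suc j ≡ 1 + suc (j + j)
  double = solve-∀

even-formula : ∀ i ℓ → ℓ + exceptionalCount (suc i + suc i) ≡ (suc i + suc i) ! * accepting (suc (suc i + suc i)) →
  2 * ℓ + 2 * ((2 * suc (suc i) ∸ 3) !!) ≡ suc (suc i) * (3 * suc (suc i) ∸ 1) * ((2 * suc (suc i) ∸ 2) !)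
even-formula i ℓ count = begin
  2 * ℓ + 2 * ((2 * suc (suc i) ∸ 3) !!)  ≡⟨ cong (λ t → 2 * ℓ + 2 * (t !!)) (∸-by _ 3 (double-minus3 i)) ⟩
  2 * ℓ + 2 * (suc i + suc i ∸ 1) !!      ≡⟨ regroup ℓ _ F A (trans (cong (ℓ +_) (sym (exceptionalCount-even (suc i)))) count) ⟩
  F * (2 * A)                             ≡⟨ cong (F *_) (accepting-odd (suc i)) ⟩
  F * ((suc i + 1) * (3 * suc i + 2))     ≡⟨ reorder F i ⟩
  suc (suc i) * (3 * i + 5) * F           ≡⟨ cong₂ (λ a b → suc (suc i) * a * b !) (sym (∸-by _ 1 (triple-minus1 i))) (sym (∸-by _ 2 (double-minus2 i))) ⟩
  suc (suc i) * (3 * suc (suc i) ∸ 1) * ((2 * suc (suc i) ∸ 2) !) ∎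
  where
  open ≡-Reasoning
  F = (suc i + suc i) !
  A = accepting (suc (suc i + suc i))
  regroup : ∀ ℓ e f a → ℓ + e ≡ f * a → 2 * ℓ + 2 * e ≡ f * (2 * a)
  regroup ℓ e f a h = trans (distrib ℓ e) (trans (cong (2 *_) h) (commute f a))
    where
    distrib : ∀ ℓ e → 2 * ℓ + 2 * e ≡ 2 * (ℓ + e)
    distrib = solve-∀
    commute : ∀ f a → 2 * (f * a) ≡ f * (2 * a)
    commute = solve-∀
  double-minus3 : ∀ i → 2 * suc (suc i) ≡ 3 + (suc i + suc i ∸ 1)
  double-minus3 i = trans (shape i) (cong (λ t → 3 + t) (sym (∸-by _ 1 (shape′ i))))
    where
    shape : ∀ i → 2 * suc (suc i) ≡ 3 + suc (i + i)
    shape = solve-∀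
    shape′ : ∀ i → suc i + suc i ≡ 1 + suc (i + i)
    shape′ = solve-∀
  reorder : ∀ f i → f * ((suc i + 1) * (3 * suc i + 2)) ≡ suc (suc i) * (3 * i + 5) * f
  reorder = solve-∀
  triple-minus1 : ∀ i → 3 * suc (suc i) ≡ 1 + (3 * i + 5)
  triple-minus1 = solve-∀
  double-minus2 : ∀ i → 2 * suc (suc i) ≡ 2 + (suc i + suc i)
  double-minus2 = solve-∀

theorem3p2 : (n : ℕ) → 3 ≤ n →
    ∃[ L ] (Unique L
    × (∀ (π : List ℕ) → (π ∈ L) ⇔ (InS n π × π ≈ ι n))
    × (∀ (k : ℕ) → n ≡ 2 * k + 1 →
         2 * length L ≡ 3 * k * (k + 1) * ((2 * k ∸ 1) !))
    × (∀ (k : ℕ) → n ≡ 2 * k →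
         2 * length L + 2 * ((2 * k ∸ 3) !!) ≡ k * (3 * k ∸ 1) * ((2 * k ∸ 2) !)))
theorem3p2 (suc (suc (suc m))) (s≤s (s≤s (s≤s z≤n))) = L , L-unique , L-members , odd , even
  where
  open IdentityClass m
  odd : ∀ k → suc (suc (suc m)) ≡ 2 * k + 1 → 2 * length L ≡ 3 * k * (k + 1) * ((2 * k ∸ 1) !)
  odd zero ()
  odd (suc j) n≡ = odd-formula j (length L) (subst (λ t → length L + exceptionalCount (suc t) ≡ suc t ! * accepting (suc (suc t))) m≡ L-length)
    where
    m≡ : m ≡ j + j
    m≡ = suc-injective (suc-injective (suc-injective (trans n≡ (shape j))))
      where
      shape : ∀ j → 2 * suc j + 1 ≡ suc (suc (suc (j + j)))
      shape = solve-∀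
  even : ∀ k → suc (suc (suc m)) ≡ 2 * k → 2 * length L + 2 * ((2 * k ∸ 3) !!) ≡ k * (3 * k ∸ 1) * ((2 * k ∸ 2) !)
  even zero ()
  even (suc zero) ()
  even (suc (suc i)) n≡ = even-formula i (length L) (subst (λ t → length L + exceptionalCount t ≡ t ! * accepting (suc t)) N≡ L-length)
    where
    N≡ : suc m ≡ suc i + suc i
    N≡ = suc-injective (suc-injective (trans n≡ (shape i)))
      where
      shape : ∀ i → 2 * suc (suc i) ≡ suc (suc (suc i + suc i))
      shape = solve-∀
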